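{- For every $0\le k<n$, $$\sum_{\substack{\pi\in\mathcal I_n(321)\\ \mathrm{des}(\pi)=k}}q^{\mathrm{maj}(\pi)}=q^{k^2}\binom{\lceil \frac{n}{2} \rceil}{k}_q\binom{\lfloor \frac{n}{2} \rfloor}{k}_q.$$
   Context: $\mathcal I_n(321)$ is the set of $321$-avoiding involutions of $\{1,\dots,n\}$; $\mathrm{des}(\pi)$ is the number of descents ($i$ with $\pi(i)>\pi(i+1)$) and $\mathrm{maj}(\pi)$ is the sum of descent positions. $\binom{a}{b}_q$ denotes the $q$-binomial coefficient. -}

module Defs where

open import Data.Nat using (ℕ; zero; suc; _+_; _*_; _∸_; _<ᵇ_; _≤ᵇ_; _≟_)
open import Data.Bool using (Bool; true; false; if_then_else_)
open import Data.List using (List; []; _∷_; length; map; concatMap; filter)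
open import Data.Nat.ListAction using (sum)
open import Data.Vec using (Vec; []; _∷_; lookup; toList)
import Data.Vec as Vec
open import Data.Fin using (Fin; toℕ; _<_; _<?_)
open import Data.Fin.Properties using (all?; any?) renaming (_≟_ to _≟ᶠ_)
open import Data.Product using (_×_; ∃; Σ-syntax)
open import Data.List using (allFin)
open import Relation.Binary.PropositionalEquality using (_≡_)
open import Relation.Nullary using (¬_; Dec; ¬?)
open import Relation.Nullary.Decidable using (_×-dec_)

-- Words / permutations.  A candidate permutation of {1,…,n} is a vector
-- π = (π(1),…,π(n)) with entries in Fin n (value v : Fin n stands for v+1).

allVecs : {A : Set} → List A → (m : ℕ) → List (Vec A m)
allVecs xs zero    = [] ∷ []
allVecs xs (suc m) = concatMap (λ x → map (x ∷_) (allVecs xs m)) xs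

allMaps : (n : ℕ) → List (Vec (Fin n) n)
allMaps n = allVecs (allFin n) n

-- involution: π(π(i)) = i for all i (this forces π to be a permutation)
IsInvolution : {n : ℕ} → Vec (Fin n) n → Set
IsInvolution π = ∀ i → lookup π (lookup π i) ≡ i

Avoids321 : {n : ℕ} → Vec (Fin n) n → Set
Avoids321 {n} π = ¬ (∃ λ i → ∃ λ j → ∃ λ l →
   (i < j) × (j < l) × (lookup π j < lookup π i) × (lookup π l < lookup π j))

isInvolution? : {n : ℕ} (π : Vec (Fin n) n) → Dec (IsInvolution π)
isInvolution? π = all? (λ i → lookup π (lookup π i) ≟ᶠ i)

avoids321? : {n : ℕ} (π : Vec (Fin n) n) → Dec (Avoids321 π)
avoids321? π = ¬? (any? λ i → any? λ j → any? λ l →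
   (i <? j) ×-dec ((j <? l) ×-dec ((lookup π j <? lookup π i) ×-dec (lookup π l <? lookup π j))))

descentPositions : ℕ → List ℕ → List ℕ
descentPositions p (x ∷ y ∷ r) =
  if y <ᵇ x then p ∷ descentPositions (suc p) (y ∷ r)
            else descentPositions (suc p) (y ∷ r)
descentPositions p _ = []

Des : {n : ℕ} → Vec (Fin n) n → List ℕ
Des π = descentPositions 1 (toList (Vec.map toℕ π))

des : {n : ℕ} → Vec (Fin n) n → ℕ
des π = length (Des π)

maj : {n : ℕ} → Vec (Fin n) n → ℕ
maj π = sum (Des π)

-- coefficient of q^m in  Σ_{π ∈ I_n(321), des π = k} q^{maj π}
lhsCoeff : (n k m : ℕ) → ℕ
lhsCoeff n k m = length (filter
  (λ π → isInvolution? π ×-dec (avoids321? π ×-dec ((des π ≟ k) ×-dec (maj π ≟ m))))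
  (allMaps n))

-- Polynomials in q with ℕ coefficients, given by their coefficient
-- function (c m = coefficient of q^m).

Poly : Set
Poly = ℕ → ℕ

sumUpTo : (ℕ → ℕ) → ℕ → ℕ
sumUpTo f zero    = f 0
sumUpTo f (suc m) = sumUpTo f m + f (suc m)

_⋆_ : Poly → Poly → Poly
(f ⋆ g) m = sumUpTo (λ i → f i * g (m ∸ i)) m

shift : ℕ → Poly → Poly
shift d f m = if d ≤ᵇ m then f (m ∸ d) else 0

one : Poly
one zero    = 1
one (suc m) = 0

qbinom : ℕ → ℕ → Poly
qbinom n       zero    = one
qbinom zero    (suc k) = λ _ → 0
qbinom (suc n) (suc k) m = qbinom n k m + shift (suc k) (qbinom n (suc k)) m

module Submission where

-- Encode an involution π of {0,…,n-1} as the word b over {U,D} with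
-- b(i) = U iff i ≤ π(i): fixed points and arc openers are U, arc closers are D.
-- When π avoids 321 its arcs do not nest, so b is a ballot word (every prefix
-- has at least as many U's as D's), the descents of π are exactly the peaks UD
-- of b, and π is recovered from b: a U is a fixed point iff no arc passes over
-- the position after it, and the r-th opener is matched with the r-th closer.
-- Hence the left side counts ballot words of length n with k peaks whose peak
-- positions sum to m.  Split by the number d of D's, these counts satisfy the
-- recurrence that the q-Pascal rule gives for q^{k²}[u,k]_q[d,k]_q, and the sum
-- over d telescopes to q^{k²}[⌈n/2⌉,k]_q[⌊n/2⌋,k]_q.

open import Defs
open import Data.Nat
open import Data.Nat.Properties
open import Data.Nat.ListAction using (sum)
open import Data.Nat.DivMod using (_mod_; m<n⇒m%n≡m)
open import Data.Nat.Induction using (<-rec)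
open import Data.Bool using (Bool; true; false; if_then_else_; T; _∧_; not)
open import Data.Bool.Properties using (∧-zeroʳ; ∧-identityʳ)
open import Data.Unit using (tt)
open import Data.Empty using (⊥; ⊥-elim)
open import Data.Product using (_×_; _,_; proj₁; proj₂; Σ)
open import Data.Sum using (inj₁; inj₂)
open import Data.List using (List; []; _∷_; _++_; length; map; concatMap; filter; allFin)
open import Data.List.Properties using (length-map; length-++)
open import Data.List.Relation.Unary.Any using (here; there)
open import Data.List.Relation.Unary.All using (All; []; _∷_)
open import Data.List.Relation.Unary.AllPairs using (AllPairs; []; _∷_)
open import Data.List.Relation.Unary.Unique.Propositional.Properties using (allFin⁺)
open import Data.List.Membership.Propositional using (_∈_; _∉_)
open import Data.List.Membership.Propositional.Properties using (∈-map⁻; ∈-map⁺; ∈-++⁻; ∈-++⁺ˡ; ∈-++⁺ʳ; ∈-∃++; ∈-allFin)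
open import Data.Vec using (Vec; []; _∷_; _∷ʳ_; lookup; tabulate; toList)
import Data.Vec as Vec
open import Data.Vec.Properties using (∷-injective; lookup∘tabulate)
open import Data.Fin using (Fin; toℕ; fromℕ<) renaming (zero to fz; suc to fs)
open import Data.Fin.Properties using (toℕ-injective; toℕ<n; toℕ-fromℕ<)
open import Relation.Binary using (tri<; tri≈; tri>)
open import Relation.Binary.PropositionalEquality
open import Relation.Nullary using (¬_; yes; no; does; Dec)
open import Relation.Nullary.Decidable using (_×-dec_; dec-true)
open import Relation.Unary using (Pred; Decidable)
open import Algebra.Properties.CommutativeSemigroup +-commutativeSemigroup
  using () renaming (interchange to +-interchange)

module Polynomials where

  _≗ₚ_ : Poly → Poly → Set
  f ≗ₚ g = ∀ m → f m ≡ g m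

  zeroP : Poly
  zeroP _ = 0

  shift-yes : ∀ d f m → d ≤ m → shift d f m ≡ f (m ∸ d)
  shift-yes d f m d≤m with d ≤ᵇ m in eq
  ... | true = refl
  ... | false = ⊥-elim (subst T eq (≤⇒≤ᵇ d≤m))

  shift-no : ∀ d f m → m < d → shift d f m ≡ 0
  shift-no d f m m<d with d ≤ᵇ m in eq
  ... | true = ⊥-elim (<⇒≱ m<d (≤ᵇ⇒≤ d m (subst T (sym eq) _)))
  ... | false = refl

  sumUpTo-cong : ∀ {f g} → (∀ i → f i ≡ g i) → ∀ m → sumUpTo f m ≡ sumUpTo g m
  sumUpTo-cong e zero = e 0
  sumUpTo-cong e (suc m) = cong₂ _+_ (sumUpTo-cong e m) (e (suc m))

  sumUpTo-congL : ∀ {f g} m → (∀ i → i ≤ m → f i ≡ g i) → sumUpTo f m ≡ sumUpTo g m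
  sumUpTo-congL zero e = e 0 z≤n
  sumUpTo-congL (suc m) e =
    cong₂ _+_ (sumUpTo-congL m (λ i i≤m → e i (m≤n⇒m≤1+n i≤m))) (e (suc m) ≤-refl)

  sumUpTo-suc : ∀ f m → sumUpTo f (suc m) ≡ f 0 + sumUpTo (λ i → f (suc i)) m
  sumUpTo-suc f zero = refl
  sumUpTo-suc f (suc m) = begin
      sumUpTo f (suc m) + f (suc (suc m))
    ≡⟨ cong (_+ f (suc (suc m))) (sumUpTo-suc f m) ⟩
      f 0 + sumUpTo (λ i → f (suc i)) m + f (suc (suc m))
    ≡⟨ +-assoc (f 0) _ _ ⟩
      f 0 + (sumUpTo (λ i → f (suc i)) m + f (suc (suc m))) ∎
    where open ≡-Reasoning

  sumUpTo-+ : ∀ f g m → sumUpTo (λ i → f i + g i) m ≡ sumUpTo f m + sumUpTo g m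
  sumUpTo-+ f g zero = refl
  sumUpTo-+ f g (suc m) =
    trans (cong (_+ (f (suc m) + g (suc m))) (sumUpTo-+ f g m))
          (+-interchange (sumUpTo f m) (sumUpTo g m) (f (suc m)) (g (suc m)))

  sumUpTo-zero : ∀ f m → (∀ i → f i ≡ 0) → sumUpTo f m ≡ 0
  sumUpTo-zero f zero e = e 0
  sumUpTo-zero f (suc m) e = cong₂ _+_ (sumUpTo-zero f m e) (e (suc m))

  sumUpTo-rev : ∀ h m → sumUpTo h m ≡ sumUpTo (λ i → h (m ∸ i)) m
  sumUpTo-rev h zero = refl
  sumUpTo-rev h (suc m) = begin
      sumUpTo h m + h (suc m)
    ≡⟨ +-comm _ (h (suc m)) ⟩
      h (suc m) + sumUpTo h m
    ≡⟨ cong (h (suc m) +_) (sumUpTo-rev h m) ⟩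
      h (suc m) + sumUpTo (λ i → h (m ∸ i)) m
    ≡⟨ sym (sumUpTo-suc (λ i → h (suc m ∸ i)) m) ⟩
      sumUpTo (λ i → h (suc m ∸ i)) (suc m) ∎
    where open ≡-Reasoning

  ⋆-comm : ∀ f g → (f ⋆ g) ≗ₚ (g ⋆ f)
  ⋆-comm f g m = begin
      sumUpTo (λ i → f i * g (m ∸ i)) m
    ≡⟨ sumUpTo-rev _ m ⟩
      sumUpTo (λ i → f (m ∸ i) * g (m ∸ (m ∸ i))) m
    ≡⟨ sumUpTo-congL m swap ⟩
      sumUpTo (λ i → g i * f (m ∸ i)) m ∎
    where
    open ≡-Reasoning
    swap : ∀ i → i ≤ m → f (m ∸ i) * g (m ∸ (m ∸ i)) ≡ g i * f (m ∸ i)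
    swap i i≤m = trans (cong (λ z → f (m ∸ i) * g z) (m∸[m∸n]≡n i≤m)) (*-comm (f (m ∸ i)) (g i))

  ⋆-cong : ∀ {f f' g g'} → f ≗ₚ f' → g ≗ₚ g' → (f ⋆ g) ≗ₚ (f' ⋆ g')
  ⋆-cong ef eg m = sumUpTo-cong (λ i → cong₂ _*_ (ef i) (eg (m ∸ i))) m

  ⋆-distribʳ : ∀ f g h m → ((λ i → f i + g i) ⋆ h) m ≡ (f ⋆ h) m + (g ⋆ h) m
  ⋆-distribʳ f g h m =
    trans (sumUpTo-cong (λ i → *-distribʳ-+ (h (m ∸ i)) (f i) (g i)) m) (sumUpTo-+ _ _ m)

  ⋆-distribˡ : ∀ f g h m → (h ⋆ (λ i → f i + g i)) m ≡ (h ⋆ f) m + (h ⋆ g) m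
  ⋆-distribˡ f g h m =
    trans (sumUpTo-cong (λ i → *-distribˡ-+ (h i) (f (m ∸ i)) (g (m ∸ i))) m) (sumUpTo-+ _ _ m)

  ⋆-zeroˡ : ∀ f g → f ≗ₚ zeroP → (f ⋆ g) ≗ₚ zeroP
  ⋆-zeroˡ f g e m = sumUpTo-zero _ m (λ i → cong (_* g (m ∸ i)) (e i))

  ⋆-zeroʳ : ∀ f g → g ≗ₚ zeroP → (f ⋆ g) ≗ₚ zeroP
  ⋆-zeroʳ f g e m = trans (⋆-comm f g m) (⋆-zeroˡ g f e m)

  shift-cong : ∀ d {f g} → f ≗ₚ g → shift d f ≗ₚ shift d g
  shift-cong d {f} {g} e m with d ≤ᵇ m
  ... | true = e (m ∸ d)
  ... | false = refl

  shift-zero : ∀ d f → f ≗ₚ zeroP → shift d f ≗ₚ zeroP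
  shift-zero d f e m with d ≤ᵇ m
  ... | true = e (m ∸ d)
  ... | false = refl

  shift-suc : ∀ d f → shift (suc d) f ≗ₚ shift 1 (shift d f)
  shift-suc d f zero = refl
  shift-suc d f (suc m) with d ≤? m
  ... | yes d≤m = trans (shift-yes (suc d) f (suc m) (s≤s d≤m)) (sym (shift-yes d f m d≤m))
  ... | no d≰m = trans (shift-no (suc d) f (suc m) (s≤s (≰⇒> d≰m))) (sym (shift-no d f m (≰⇒> d≰m)))

  shift-+ : ∀ a b f → shift a (shift b f) ≗ₚ shift (a + b) f
  shift-+ zero b f m = refl
  shift-+ (suc a) b f m = begin
      shift (suc a) (shift b f) m
    ≡⟨ shift-suc a (shift b f) m ⟩
      shift 1 (shift a (shift b f)) m
    ≡⟨ shift-cong 1 (shift-+ a b f) m ⟩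
      shift 1 (shift (a + b) f) m
    ≡⟨ sym (shift-suc (a + b) f m) ⟩
      shift (suc a + b) f m ∎
    where open ≡-Reasoning

  shift-+P : ∀ d f g m → shift d (λ i → f i + g i) m ≡ shift d f m + shift d g m
  shift-+P d f g m with d ≤ᵇ m
  ... | true = refl
  ... | false = refl

  shift1-⋆ : ∀ f g → (shift 1 f ⋆ g) ≗ₚ shift 1 (f ⋆ g)
  shift1-⋆ f g zero = refl
  shift1-⋆ f g (suc m) = sumUpTo-suc (λ i → shift 1 f i * g (suc m ∸ i)) m

  shift-⋆ : ∀ a f g → (shift a f ⋆ g) ≗ₚ shift a (f ⋆ g)
  shift-⋆ zero f g m = refl
  shift-⋆ (suc a) f g m = begin
      (shift (suc a) f ⋆ g) m
    ≡⟨ ⋆-cong {g = g} (shift-suc a f) (λ _ → refl) m ⟩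
      (shift 1 (shift a f) ⋆ g) m
    ≡⟨ shift1-⋆ (shift a f) g m ⟩
      shift 1 (shift a f ⋆ g) m
    ≡⟨ shift-cong 1 (shift-⋆ a f g) m ⟩
      shift 1 (shift a (f ⋆ g)) m
    ≡⟨ sym (shift-suc a (f ⋆ g) m) ⟩
      shift (suc a) (f ⋆ g) m ∎
    where open ≡-Reasoning

  ⋆-shift : ∀ a f g → (f ⋆ shift a g) ≗ₚ shift a (f ⋆ g)
  ⋆-shift a f g m =
    trans (⋆-comm f (shift a g) m) (trans (shift-⋆ a g f m) (shift-cong a (⋆-comm g f) m))

-- The recurrence for q^{k²}[u,k][d,k] needs the second rule
--   [n+1,k+1] = q^{n-k} [n,k] + [n,k+1],
-- which is derived here by induction on n from the first.
module GaussianCoefficients where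

  open Polynomials

  qbinom-vanish : ∀ n k → n < k → qbinom n k ≗ₚ zeroP
  qbinom-vanish zero (suc k) _ m = refl
  qbinom-vanish (suc n) (suc k) (s≤s n<k) m =
    cong₂ _+_ (qbinom-vanish n k n<k m)
              (shift-zero (suc k) _ (qbinom-vanish n (suc k) (m≤n⇒m≤1+n n<k)) m)

  -- q^{j+2} q^{n-(j+1)} [n,j+1] = q^{n-j} q^{j+1} [n,j+1]: both exponents are
  -- n+1 when j < n, and both sides vanish otherwise
  shift-exponents : ∀ n j →
    shift (suc (suc j)) (shift (n ∸ suc j) (qbinom n (suc j))) ≗ₚ
    shift (n ∸ j) (shift (suc j) (qbinom n (suc j)))
  shift-exponents n j m with suc j ≤? n
  ... | yes j<n = begin
      shift (suc (suc j)) (shift (n ∸ suc j) C) m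
    ≡⟨ shift-+ (suc (suc j)) (n ∸ suc j) C m ⟩
      shift (suc (suc j) + (n ∸ suc j)) C m
    ≡⟨ cong (λ e → shift e C m) exponents ⟩
      shift (n ∸ j + suc j) C m
    ≡⟨ sym (shift-+ (n ∸ j) (suc j) C m) ⟩
      shift (n ∸ j) (shift (suc j) C) m ∎
    where
    open ≡-Reasoning
    C = qbinom n (suc j)
    exponents : suc (suc j) + (n ∸ suc j) ≡ n ∸ j + suc j
    exponents = begin
      suc (suc j) + (n ∸ suc j) ≡⟨ cong suc (m+[n∸m]≡n j<n) ⟩
      suc n                     ≡⟨ cong suc (sym (m∸n+n≡m (<⇒≤ j<n))) ⟩
      suc (n ∸ j + j)           ≡⟨ sym (+-suc (n ∸ j) j) ⟩
      n ∸ j + suc j             ∎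
  ... | no j≮n = trans (shift-zero (suc (suc j)) _ (shift-zero (n ∸ suc j) _ C≗0) m)
                       (sym (shift-zero (n ∸ j) _ (shift-zero (suc j) _ C≗0) m))
    where C≗0 = qbinom-vanish n (suc j) (≰⇒> j≮n)

  qbinom-pascal₂ : ∀ n k → qbinom (suc n) (suc k) ≗ₚ
                           (λ m → shift (n ∸ k) (qbinom n k) m + qbinom n (suc k) m)
  qbinom-pascal₂ zero zero m = cong (one m +_) (shift-zero 1 _ (λ _ → refl) m)
  qbinom-pascal₂ zero (suc k) m = shift-zero (suc (suc k)) _ (λ _ → refl) m
  qbinom-pascal₂ (suc n) zero m = begin
      one m + shift 1 (qbinom (suc n) 1) m
    ≡⟨ cong (one m +_) (shift-cong 1 (qbinom-pascal₂ n zero) m) ⟩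
      one m + shift 1 (λ i → shift n one i + qbinom n 1 i) m
    ≡⟨ cong (one m +_) (shift-+P 1 (shift n one) (qbinom n 1) m) ⟩
      one m + (shift 1 (shift n one) m + shift 1 (qbinom n 1) m)
    ≡⟨ cong (λ z → one m + (z + shift 1 (qbinom n 1) m)) (shift-+ 1 n one m) ⟩
      one m + (shift (suc n) one m + shift 1 (qbinom n 1) m)
    ≡⟨ sym (+-assoc (one m) _ _) ⟩
      one m + shift (suc n) one m + shift 1 (qbinom n 1) m
    ≡⟨ cong (_+ shift 1 (qbinom n 1) m) (+-comm (one m) _) ⟩
      shift (suc n) one m + one m + shift 1 (qbinom n 1) m
    ≡⟨ +-assoc (shift (suc n) one m) _ _ ⟩
      shift (suc n) one m + qbinom (suc n) 1 m ∎
    where open ≡-Reasoning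
  qbinom-pascal₂ (suc n) (suc j) m = begin
      (A m + B m) + shift (suc (suc j)) (qbinom (suc n) (suc (suc j))) m
    ≡⟨ cong₂ _+_ (qbinom-pascal₂ n j m) second ⟩
      (shift (n ∸ j) A m + C m) + (shift (suc (suc j)) (shift (n ∸ suc j) C) m + shift (suc (suc j)) D m)
    ≡⟨ cong (λ z → (shift (n ∸ j) A m + C m) + (z + shift (suc (suc j)) D m)) (shift-exponents n j m) ⟩
      (shift (n ∸ j) A m + C m) + (shift (n ∸ j) B m + shift (suc (suc j)) D m)
    ≡⟨ +-interchange (shift (n ∸ j) A m) (C m) (shift (n ∸ j) B m) _ ⟩
      (shift (n ∸ j) A m + shift (n ∸ j) B m) + (C m + shift (suc (suc j)) D m)
    ≡⟨ cong (_+ (C m + shift (suc (suc j)) D m)) (sym (shift-+P (n ∸ j) A B m)) ⟩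
      shift (n ∸ j) (qbinom (suc n) (suc j)) m + qbinom (suc n) (suc (suc j)) m ∎
    where
    open ≡-Reasoning
    A = qbinom n j
    C = qbinom n (suc j)
    B = shift (suc j) C
    D = qbinom n (suc (suc j))
    -- the induction hypothesis for (n, j+1), shifted by q^{j+2}
    second : shift (suc (suc j)) (qbinom (suc n) (suc (suc j))) m
           ≡ shift (suc (suc j)) (shift (n ∸ suc j) C) m + shift (suc (suc j)) D m
    second = trans (shift-cong (suc (suc j)) (qbinom-pascal₂ n (suc j)) m)
                   (shift-+P (suc (suc j)) (shift (n ∸ suc j) C) D m)

-- The right-hand side gaussProd u d k = q^{k²}[u,k]_q[d,k]_q and its recurrence
--   W(u+1,d+1,k) + W(u,d,k) = W(u,d+1,k) + W(u+1,d,k) + q^{u+d+1} W(u,d,k-1),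
-- obtained by expanding [u+1,k][d+1,k] with the second q-Pascal rule.
module GaussianProducts where

  open Polynomials
  open GaussianCoefficients
  open import Data.Nat.Solver using (module +-*-Solver)
  open +-*-Solver

  gaussProd : ℕ → ℕ → ℕ → Poly
  gaussProd u d k = shift (k * k) (qbinom u k ⋆ qbinom d k)

  qShiftPred : ℕ → (ℕ → Poly) → ℕ → ℕ → ℕ
  qShiftPred N F zero m = 0
  qShiftPred N F (suc j) m = shift N (F j) m

  qShiftPred-+ : ∀ N (F G H : ℕ → Poly) → (∀ j i → F j i + G j i ≡ H j i) →
                 ∀ k m → qShiftPred N F k m + qShiftPred N G k m ≡ qShiftPred N H k m
  qShiftPred-+ N F G H e zero m = refl
  qShiftPred-+ N F G H e (suc j) m =
    trans (sym (shift-+P N (F j) (G j) m)) (shift-cong N (e j) m)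

  gaussProd-sym : ∀ u d k → gaussProd u d k ≗ₚ gaussProd d u k
  gaussProd-sym u d k = shift-cong (k * k) (⋆-comm (qbinom u k) (qbinom d k))

  ⋆-expand : ∀ X a Y b m →
    ((λ i → X i + a i) ⋆ (λ i → Y i + b i)) m + (a ⋆ b) m ≡
    (a ⋆ (λ i → Y i + b i)) m + ((λ i → X i + a i) ⋆ b) m + (X ⋆ Y) m
  ⋆-expand X a Y b m = begin
      (XA ⋆ YB) m + (a ⋆ b) m
    ≡⟨ cong (_+ (a ⋆ b) m) (trans (⋆-distribˡ Y b XA m)
                                  (cong₂ _+_ (⋆-distribʳ X a Y m) (⋆-distribʳ X a b m))) ⟩
      ((X ⋆ Y) m + (a ⋆ Y) m) + ((X ⋆ b) m + (a ⋆ b) m) + (a ⋆ b) m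
    ≡⟨ rearrange ((X ⋆ Y) m) ((a ⋆ Y) m) ((X ⋆ b) m) ((a ⋆ b) m) ⟩
      ((a ⋆ Y) m + (a ⋆ b) m) + ((X ⋆ b) m + (a ⋆ b) m) + (X ⋆ Y) m
    ≡⟨ sym (cong₂ (λ p q → p + q + (X ⋆ Y) m) (⋆-distribˡ Y b a m) (⋆-distribʳ X a b m)) ⟩
      (a ⋆ YB) m + (XA ⋆ b) m + (X ⋆ Y) m ∎
    where
    open ≡-Reasoning
    XA YB : Poly
    XA i = X i + a i
    YB i = Y i + b i
    rearrange : ∀ p q r t → (p + q) + (r + t) + t ≡ (q + t) + (r + t) + p
    rearrange = solve 4 (λ p q r t → (p :+ q) :+ (r :+ t) :+ t := (q :+ t) :+ (r :+ t) :+ p) refl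

  gaussProd-exponent : ∀ j u d → j ≤ u → j ≤ d →
                       suc j * suc j + (u ∸ j + (d ∸ j)) ≡ u + suc d + j * j
  gaussProd-exponent j u d ju jd with m≤n⇒∃[o]m+o≡n ju | m≤n⇒∃[o]m+o≡n jd
  ... | x , refl | y , refl = begin
      suc j * suc j + (j + x ∸ j + (j + y ∸ j))
    ≡⟨ cong₂ (λ p q → suc j * suc j + (p + q)) (m+n∸m≡n j x) (m+n∸m≡n j y) ⟩
      suc j * suc j + (x + y)
    ≡⟨ solve 3 (λ j x y → (con 1 :+ j) :* (con 1 :+ j) :+ (x :+ y)
                        := j :+ x :+ (con 1 :+ (j :+ y)) :+ j :* j) refl j x y ⟩
      j + x + suc (j + y) + j * j ∎
    where open ≡-Reasoning

  cross-term : ∀ u d j →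
    shift (suc j * suc j) (shift (u ∸ j) (qbinom u j) ⋆ shift (d ∸ j) (qbinom d j))
    ≗ₚ shift (u + suc d) (gaussProd u d j)
  cross-term u d j m = begin
      shift s (shift (u ∸ j) a ⋆ shift (d ∸ j) b) m
    ≡⟨ shift-cong s shifts-out m ⟩
      shift s (shift (u ∸ j + (d ∸ j)) (a ⋆ b)) m
    ≡⟨ shift-+ s (u ∸ j + (d ∸ j)) (a ⋆ b) m ⟩
      shift (s + (u ∸ j + (d ∸ j))) (a ⋆ b) m
    ≡⟨ exponent ⟩
      shift (u + suc d + j * j) (a ⋆ b) m
    ≡⟨ sym (shift-+ (u + suc d) (j * j) (a ⋆ b) m) ⟩
      shift (u + suc d) (gaussProd u d j) m ∎
    where
    open ≡-Reasoning
    s = suc j * suc j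
    a = qbinom u j
    b = qbinom d j
    shifts-out : (shift (u ∸ j) a ⋆ shift (d ∸ j) b) ≗ₚ shift (u ∸ j + (d ∸ j)) (a ⋆ b)
    shifts-out i = trans (shift-⋆ (u ∸ j) a (shift (d ∸ j) b) i)
                         (trans (shift-cong (u ∸ j) (⋆-shift (d ∸ j) a b) i) (shift-+ (u ∸ j) (d ∸ j) (a ⋆ b) i))
    -- the exponents agree unless j exceeds u or d, when [u,j][d,j] vanishes
    vanish : (a ⋆ b) ≗ₚ zeroP → ∀ e e' → shift e (a ⋆ b) m ≡ shift e' (a ⋆ b) m
    vanish z e e' = trans (shift-zero e (a ⋆ b) z m) (sym (shift-zero e' (a ⋆ b) z m))
    e₁ = s + (u ∸ j + (d ∸ j))
    e₂ = u + suc d + j * j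
    exponent : shift e₁ (a ⋆ b) m ≡ shift e₂ (a ⋆ b) m
    exponent with j ≤? u | j ≤? d
    ... | yes ju | yes jd = cong (λ e → shift e (a ⋆ b) m) (gaussProd-exponent j u d ju jd)
    ... | no ju  | _      = vanish (⋆-zeroˡ a b (qbinom-vanish u j (≰⇒> ju))) e₁ e₂
    ... | yes _  | no jd  = vanish (⋆-zeroʳ a b (qbinom-vanish d j (≰⇒> jd))) e₁ e₂

  gaussProd-rec : ∀ u d k m →
    gaussProd (suc u) (suc d) k m + gaussProd u d k m ≡
    gaussProd u (suc d) k m + gaussProd (suc u) d k m + qShiftPred (u + suc d) (gaussProd u d) k m
  gaussProd-rec u d zero m = sym (+-identityʳ _)
  gaussProd-rec u d (suc j) m = begin
      shift s (U ⋆ D) m + shift s (a ⋆ b) m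
    ≡⟨ sym (shift-+P s (U ⋆ D) (a ⋆ b) m) ⟩
      shift s (λ i → (U ⋆ D) i + (a ⋆ b) i) m
    ≡⟨ shift-cong s expanded m ⟩
      shift s (λ i → (a ⋆ D) i + (U ⋆ b) i + (X ⋆ Y) i) m
    ≡⟨ shift-+P s (λ i → (a ⋆ D) i + (U ⋆ b) i) (X ⋆ Y) m ⟩
      shift s (λ i → (a ⋆ D) i + (U ⋆ b) i) m + shift s (X ⋆ Y) m
    ≡⟨ cong (_+ shift s (X ⋆ Y) m) (shift-+P s (a ⋆ D) (U ⋆ b) m) ⟩
      shift s (a ⋆ D) m + shift s (U ⋆ b) m + shift s (X ⋆ Y) m
    ≡⟨ cong (shift s (a ⋆ D) m + shift s (U ⋆ b) m +_) (cross-term u d j m) ⟩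
      gaussProd u (suc d) (suc j) m + gaussProd (suc u) d (suc j) m
        + qShiftPred (u + suc d) (gaussProd u d) (suc j) m ∎
    where
    open ≡-Reasoning
    s = suc j * suc j
    a = qbinom u (suc j)
    b = qbinom d (suc j)
    X = shift (u ∸ j) (qbinom u j)
    Y = shift (d ∸ j) (qbinom d j)
    U = qbinom (suc u) (suc j)
    D = qbinom (suc d) (suc j)
    -- U = X + a and D = Y + b by the second q-Pascal rule
    expanded : ∀ i → (U ⋆ D) i + (a ⋆ b) i ≡ (a ⋆ D) i + (U ⋆ b) i + (X ⋆ Y) i
    expanded i = begin
        (U ⋆ D) i + (a ⋆ b) i
      ≡⟨ cong (_+ (a ⋆ b) i) (⋆-cong (qbinom-pascal₂ u j) (qbinom-pascal₂ d j) i) ⟩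
        ((λ i → X i + a i) ⋆ (λ i → Y i + b i)) i + (a ⋆ b) i
      ≡⟨ ⋆-expand X a Y b i ⟩
        (a ⋆ (λ i → Y i + b i)) i + ((λ i → X i + a i) ⋆ b) i + (X ⋆ Y) i
      ≡⟨ sym (cong₂ (λ p q → p + q + (X ⋆ Y) i)
                    (⋆-cong {a} (λ _ → refl) (qbinom-pascal₂ d j) i)
                    (⋆-cong {g = b} (qbinom-pascal₂ u j) (λ _ → refl) i)) ⟩
        (a ⋆ D) i + (U ⋆ b) i + (X ⋆ Y) i ∎

module BoolReflection where

  T-true : ∀ {b} → T b → b ≡ true
  T-true {true} _ = refl

  true-T : ∀ {b} → b ≡ true → T b
  true-T refl = tt

  eqb-true : ∀ a b → a ≡ b → (a ≡ᵇ b) ≡ true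
  eqb-true a b e = T-true (≡⇒≡ᵇ a b e)

  eqb-false : ∀ a b → a ≢ b → (a ≡ᵇ b) ≡ false
  eqb-false a b ne with a ≡ᵇ b in eq
  ... | true = ⊥-elim (ne (≡ᵇ⇒≡ a b (true-T eq)))
  ... | false = refl

  eqb-sound : ∀ a b → (a ≡ᵇ b) ≡ true → a ≡ b
  eqb-sound a b e = ≡ᵇ⇒≡ a b (true-T e)

  leqb-true : ∀ a b → a ≤ b → (a ≤ᵇ b) ≡ true
  leqb-true a b p = T-true (≤⇒≤ᵇ p)

  leqb-false : ∀ a b → ¬ (a ≤ b) → (a ≤ᵇ b) ≡ false
  leqb-false a b np with a ≤ᵇ b in eq
  ... | true = ⊥-elim (np (≤ᵇ⇒≤ a b (true-T eq)))
  ... | false = refl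

  leqb-sound : ∀ a b → (a ≤ᵇ b) ≡ true → a ≤ b
  leqb-sound a b e = ≤ᵇ⇒≤ a b (true-T e)

  leqb-cong : ∀ a b c e → (a ≤ b → c ≤ e) → (c ≤ e → a ≤ b) → (a ≤ᵇ b) ≡ (c ≤ᵇ e)
  leqb-cong a b c e f g with a ≤? b
  ... | yes p = trans (leqb-true a b p) (sym (leqb-true c e (f p)))
  ... | no np = trans (leqb-false a b np) (sym (leqb-false c e (λ q → np (g q))))

  ∧-true₁ : ∀ {a b} → (a ∧ b) ≡ true → a ≡ true
  ∧-true₁ {true} _ = refl

  ∧-true₂ : ∀ {a b} → (a ∧ b) ≡ true → b ≡ true
  ∧-true₂ {true} e = e

  eqb-plus : ∀ a c m → (a + c ≡ᵇ m) ≡ ((c ≤ᵇ m) ∧ (a ≡ᵇ m ∸ c))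
  eqb-plus a c m with c ≤? m
  ... | no c≰m = trans (eqb-false (a + c) m (λ e → c≰m (subst (c ≤_) e (m≤n+m c a))))
                       (cong (_∧ (a ≡ᵇ m ∸ c)) (sym (leqb-false c m c≰m)))
  ... | yes c≤m rewrite leqb-true c m c≤m with a ≟ m ∸ c
  ...   | yes refl = trans (eqb-true _ _ (m∸n+n≡m c≤m)) (sym (eqb-true (m ∸ c) (m ∸ c) refl))
  ...   | no ne = trans (eqb-false _ _ (λ e → ne (trans (sym (m+n∸n≡m a c)) (cong (_∸ c) e))))
                        (sym (eqb-false _ _ ne))

  eqPred : ℕ → ℕ → Bool
  eqPred zero a = false
  eqPred (suc j) a = a ≡ᵇ j

  eqb-plus1 : ∀ a k → (a + 1 ≡ᵇ k) ≡ eqPred k a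
  eqb-plus1 a zero = eqb-false (a + 1) 0 (λ e → 1+n≢0 (trans (+-comm 1 a) e))
  eqb-plus1 a (suc j) = cong (_≡ᵇ suc j) (+-comm a 1)

  ltb-true : ∀ a b → a < b → (a <ᵇ b) ≡ true
  ltb-true a b p = T-true (<⇒<ᵇ p)

  ltb-false : ∀ a b → ¬ (a < b) → (a <ᵇ b) ≡ false
  ltb-false a b np with a <ᵇ b in eq
  ... | true = ⊥-elim (np (<ᵇ⇒< a b (true-T eq)))
  ... | false = refl


-- Words over {U,D} are Boolean vectors (true = U, false = D), read through
-- `letter` as functions ℕ → Bool with positions 0,1,….
module Words where

  ind : Bool → ℕ
  ind true = 1
  ind false = 0

  sumTo : (ℕ → ℕ) → ℕ → ℕ
  sumTo f zero = 0
  sumTo f (suc N) = sumTo f N + f N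

  sumTo-congL : ∀ {f g} N → (∀ i → i < N → f i ≡ g i) → sumTo f N ≡ sumTo g N
  sumTo-congL zero e = refl
  sumTo-congL (suc N) e =
    cong₂ _+_ (sumTo-congL N (λ i i<N → e i (m<n⇒m<1+n i<N))) (e N ≤-refl)

  letter : ∀ {n} → Vec Bool n → ℕ → Bool
  letter [] i = false
  letter (x ∷ v) zero = x
  letter (x ∷ v) (suc i) = letter v i

  letter-snoc-< : ∀ {n} (v : Vec Bool n) x i → i < n → letter (v ∷ʳ x) i ≡ letter v i
  letter-snoc-< (y ∷ v) x zero _ = refl
  letter-snoc-< (y ∷ v) x (suc i) (s≤s i<n) = letter-snoc-< v x i i<n

  letter-snoc-last : ∀ {n} (v : Vec Bool n) x → letter (v ∷ʳ x) n ≡ x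
  letter-snoc-last [] x = refl
  letter-snoc-last (y ∷ v) x = letter-snoc-last v x

  countU : (ℕ → Bool) → ℕ → ℕ
  countU w j = sumTo (λ i → ind (w i)) j

  countD : (ℕ → Bool) → ℕ → ℕ
  countD w j = sumTo (λ i → ind (not (w i))) j

  isBallot : (ℕ → Bool) → ℕ → Bool
  isBallot w zero = true
  isBallot w (suc j) = isBallot w j ∧ (countD w (suc j) ≤ᵇ countU w (suc j))

  module _ {w w' : ℕ → Bool} {n : ℕ} (same : ∀ i → i < n → w i ≡ w' i) where
    countU-cong : ∀ j → j ≤ n → countU w j ≡ countU w' j
    countU-cong j j≤n = sumTo-congL j (λ i i<j → cong ind (same i (≤-trans i<j j≤n)))

    countD-cong : ∀ j → j ≤ n → countD w j ≡ countD w' j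
    countD-cong j j≤n = sumTo-congL j (λ i i<j → cong (λ x → ind (not x)) (same i (≤-trans i<j j≤n)))

    isBallot-cong : ∀ j → j ≤ n → isBallot w j ≡ isBallot w' j
    isBallot-cong zero _ = refl
    isBallot-cong (suc j) sj≤n = cong₂ _∧_ (isBallot-cong j (≤-trans (n≤1+n j) sj≤n))
                                            (cong₂ _≤ᵇ_ (countD-cong (suc j) sj≤n) (countU-cong (suc j) sj≤n))

  -- a peak at i is a factor U D at positions i, i+1; it sits at 1-based position i+1
  peak : (ℕ → Bool) → ℕ → Bool
  peak w i = w i ∧ not (w (suc i))

  peakCount : (ℕ → Bool) → ℕ → ℕ
  peakCount w N = sumTo (λ i → ind (peak w i)) N

  peakSum : (ℕ → Bool) → ℕ → ℕ
  peakSum w N = sumTo (λ i → if peak w i then suc i else 0) N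

  ballotStat : (n d k m : ℕ) → Vec Bool n → Bool
  ballotStat n d k m v =
    isBallot (letter v) n ∧ ((countD (letter v) n ≡ᵇ d) ∧
      ((peakCount (letter v) (pred n) ≡ᵇ k) ∧ (peakSum (letter v) (pred n) ≡ᵇ m)))

  countWords : (n : ℕ) → (Vec Bool n → Bool) → ℕ
  countWords zero P = ind (P [])
  countWords (suc n) P = countWords n (λ v → P (true ∷ v)) + countWords n (λ v → P (false ∷ v))

  countWords-cong : ∀ n {P Q : Vec Bool n → Bool} → (∀ v → P v ≡ Q v) →
                    countWords n P ≡ countWords n Q
  countWords-cong zero e = cong ind (e [])
  countWords-cong (suc n) e =
    cong₂ _+_ (countWords-cong n (λ v → e (true ∷ v))) (countWords-cong n (λ v → e (false ∷ v)))

  countWords-false : ∀ n {P : Vec Bool n → Bool} → (∀ v → P v ≡ false) → countWords n P ≡ 0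
  countWords-false zero e = cong ind (e [])
  countWords-false (suc n) e =
    cong₂ _+_ (countWords-false n (λ v → e (true ∷ v))) (countWords-false n (λ v → e (false ∷ v)))

  countWords-snoc : ∀ n (P : Vec Bool (suc n) → Bool) →
    countWords (suc n) P ≡ countWords n (λ v → P (v ∷ʳ true)) + countWords n (λ v → P (v ∷ʳ false))
  countWords-snoc zero P = refl
  countWords-snoc (suc n) P =
    trans (cong₂ _+_ (countWords-snoc n (λ v → P (true ∷ v))) (countWords-snoc n (λ v → P (false ∷ v))))
          (+-interchange (# λ v → P (true ∷ (v ∷ʳ true))) (# λ v → P (true ∷ (v ∷ʳ false)))
                         (# λ v → P (false ∷ (v ∷ʳ true))) (# λ v → P (false ∷ (v ∷ʳ false))))
    where # = countWords n

  countWords-split : ∀ n (P Q : Vec Bool n → Bool) →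
    countWords n P ≡ countWords n (λ v → P v ∧ Q v) + countWords n (λ v → P v ∧ not (Q v))
  countWords-split zero P Q with P [] | Q []
  ... | true | true = refl
  ... | true | false = refl
  ... | false | true = refl
  ... | false | false = refl
  countWords-split (suc n) P Q =
    trans (cong₂ _+_ (countWords-split n (λ v → P (true ∷ v)) (λ v → Q (true ∷ v)))
                     (countWords-split n (λ v → P (false ∷ v)) (λ v → Q (false ∷ v))))
          (+-interchange (# λ v → P (true ∷ v) ∧ Q (true ∷ v)) (# λ v → P (true ∷ v) ∧ not (Q (true ∷ v)))
                         (# λ v → P (false ∷ v) ∧ Q (false ∷ v)) (# λ v → P (false ∷ v) ∧ not (Q (false ∷ v))))
    where # = countWords n

  countWords-if : ∀ n (c : Bool) (P : Vec Bool n → Bool) →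
                  countWords n (λ v → c ∧ P v) ≡ (if c then countWords n P else 0)
  countWords-if n true P = refl
  countWords-if n false P = countWords-false n (λ _ → refl)

-- How the statistics of a word change when one letter is appended.  This is
-- what drives the recurrence for ballot words: appending U changes nothing but
-- the length, and appending D to a word ending in U creates a new peak.
module WordSnoc where

  open Words
  open BoolReflection

  module _ {n} (v : Vec Bool n) (x : Bool) where
    private
      w' = letter (v ∷ʳ x)
      w = letter v
      same : ∀ i → i < n → w' i ≡ w i
      same = letter-snoc-< v x

    countU-snoc : countU w' (suc n) ≡ countU w n + ind x
    countU-snoc = cong₂ _+_ (countU-cong same n ≤-refl) (cong ind (letter-snoc-last v x))

    countD-snoc : countD w' (suc n) ≡ countD w n + ind (not x)
    countD-snoc = cong₂ _+_ (countD-cong same n ≤-refl) (cong (λ b → ind (not b)) (letter-snoc-last v x))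

    peak-snoc-< : ∀ i → suc i < n → peak w' i ≡ peak w i
    peak-snoc-< i si<n =
      cong₂ (λ a b → a ∧ not b) (same i (≤-trans (n≤1+n (suc i)) si<n)) (same (suc i) si<n)

    peakCount-snoc-≤ : ∀ j → suc j ≤ n → peakCount w' j ≡ peakCount w j
    peakCount-snoc-≤ j sj≤n =
      sumTo-congL j (λ i i<j → cong ind (peak-snoc-< i (≤-trans (s≤s i<j) sj≤n)))

    peakSum-snoc-≤ : ∀ j → suc j ≤ n → peakSum w' j ≡ peakSum w j
    peakSum-snoc-≤ j sj≤n =
      sumTo-congL j (λ i i<j → cong (λ b → if b then suc i else 0) (peak-snoc-< i (≤-trans (s≤s i<j) sj≤n)))

  newPeak : ∀ {n} → Vec Bool n → Bool → ℕ
  newPeak {zero} v x = 0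
  newPeak {suc n'} v x = ind (letter v n' ∧ not x)

  newPeakPos : ∀ {n} → Vec Bool n → Bool → ℕ
  newPeakPos {zero} v x = 0
  newPeakPos {suc n'} v x = if letter v n' ∧ not x then suc n' else 0

  peakCount-snoc : ∀ {n} (v : Vec Bool n) x →
    peakCount (letter (v ∷ʳ x)) n ≡ peakCount (letter v) (pred n) + newPeak v x
  peakCount-snoc {zero} v x = refl
  peakCount-snoc {suc n'} v x = cong₂ _+_ (peakCount-snoc-≤ v x n' ≤-refl)
    (cong ind (cong₂ (λ a b → a ∧ not b) (letter-snoc-< v x n' ≤-refl) (letter-snoc-last v x)))

  peakSum-snoc : ∀ {n} (v : Vec Bool n) x →
    peakSum (letter (v ∷ʳ x)) n ≡ peakSum (letter v) (pred n) + newPeakPos v x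
  peakSum-snoc {zero} v x = refl
  peakSum-snoc {suc n'} v x = cong₂ _+_ (peakSum-snoc-≤ v x n' ≤-refl)
    (cong (λ b → if b then suc n' else 0)
          (cong₂ (λ a b → a ∧ not b) (letter-snoc-< v x n' ≤-refl) (letter-snoc-last v x)))

  ballotStat-snoc : ∀ {n} d k m (v : Vec Bool n) x → let w = letter v in
    ballotStat (suc n) d k m (v ∷ʳ x) ≡
    (isBallot w n ∧ (countD w n + ind (not x) ≤ᵇ countU w n + ind x)) ∧
    ((countD w n + ind (not x) ≡ᵇ d) ∧
     ((peakCount w (pred n) + newPeak v x ≡ᵇ k) ∧ (peakSum w (pred n) + newPeakPos v x ≡ᵇ m)))
  ballotStat-snoc {n} d k m v x =
    cong₂ _∧_ (cong₂ _∧_ (isBallot-cong (letter-snoc-< v x) n ≤-refl) (cong₂ _≤ᵇ_ (countD-snoc v x) (countU-snoc v x)))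
      (cong₂ _∧_ (cong (_≡ᵇ d) (countD-snoc v x))
                 (cong₂ _∧_ (cong (_≡ᵇ k) (peakCount-snoc v x)) (cong (_≡ᵇ m) (peakSum-snoc v x))))
    where w = letter v

  countU+countD : ∀ w j → countU w j + countD w j ≡ j
  countU+countD w zero = refl
  countU+countD w (suc j) with w j
  ... | true = trans (+-interchange (countU w j) 1 (countD w j) 0)
                     (trans (cong (_+ 1) (countU+countD w j)) (+-comm j 1))
  ... | false = trans (+-interchange (countU w j) 0 (countD w j) 1)
                      (trans (cong (_+ 1) (countU+countD w j)) (+-comm j 1))

  isBallot-last : ∀ w j → isBallot w j ≡ true → countD w j ≤ countU w j
  isBallot-last w zero _ = z≤n
  isBallot-last w (suc j) e = leqb-sound _ _ (∧-true₂ {isBallot w j} e)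

  ballotStat-U : ∀ {n} d k m (v : Vec Bool n) →
                 ballotStat (suc n) d k m (v ∷ʳ true) ≡ ballotStat n d k m v
  ballotStat-U {n} d k m v = trans (ballotStat-snoc d k m v true) (cong₂ _∧_ stillBallot
     (cong₂ _∧_ (cong (_≡ᵇ d) (+-identityʳ (countD w n)))
       (cong₂ _∧_ (cong (_≡ᵇ k) (trans (cong (peakCount w (pred n) +_) (noPeak n v)) (+-identityʳ _)))
                  (cong (_≡ᵇ m) (trans (cong (peakSum w (pred n) +_) (noPeakPos n v)) (+-identityʳ _))))))
    where
    w = letter v
    noPeak : ∀ n (v : Vec Bool n) → newPeak v true ≡ 0
    noPeak zero v = refl
    noPeak (suc n) v = cong ind (∧-zeroʳ (letter v n))
    noPeakPos : ∀ n (v : Vec Bool n) → newPeakPos v true ≡ 0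
    noPeakPos zero v = refl
    noPeakPos (suc n) v = cong (λ b → if b then suc n else 0) (∧-zeroʳ (letter v n))
    stillBallot : (isBallot w n ∧ (countD w n + 0 ≤ᵇ countU w n + 1)) ≡ isBallot w n
    stillBallot with isBallot w n in eq
    ... | true = leqb-true _ _ (≤-trans (≤-reflexive (+-identityʳ _))
                                        (≤-trans (isBallot-last w n eq) (m≤m+n _ 1)))
    ... | false = refl

  ballotStat-D-noD : ∀ {n} k m (v : Vec Bool n) → ballotStat (suc n) 0 k m (v ∷ʳ false) ≡ false
  ballotStat-D-noD {n} k m v = trans (ballotStat-snoc 0 k m v false)
    (trans (cong (λ z → (isBallot w n ∧ (countD w n + 1 ≤ᵇ countU w n + 0)) ∧ (z ∧ peaks))
                 (eqb-false (countD w n + 1) 0 (λ e → 1+n≢0 (trans (+-comm 1 _) e))))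
           (∧-zeroʳ _))
    where
    w = letter v
    peaks = (peakCount w (pred n) + newPeak v false ≡ᵇ k) ∧ (peakSum w (pred n) + newPeakPos v false ≡ᵇ m)

  -- The condition on a word w' = v·x of length n+1 for w'·D to be counted with
  -- d+1 D's, k peaks and peak sum m, given the statistics B, D, K, M of w':
  -- if x = D nothing changes; if x = U the final D creates a peak at n+1.
  peakCase : (d k m n : ℕ) (B : Bool) (x : Bool) (D K M : ℕ) → Bool
  peakCase d k m n B false D K M = B ∧ ((D ≡ᵇ d) ∧ ((K ≡ᵇ k) ∧ (M ≡ᵇ m)))
  peakCase d zero m n B true D K M = false
  peakCase d (suc j) m n B true D K M =
    (suc n ≤ᵇ m) ∧ (B ∧ ((D ≡ᵇ d) ∧ ((K ≡ᵇ j) ∧ (M ≡ᵇ m ∸ suc n))))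

  beforeFinalD : (n d k m : ℕ) → Bool → Vec Bool (suc n) → Bool
  beforeFinalD n d k m x w' =
    peakCase d k m n (isBallot w (suc n)) x (countD w (suc n)) (peakCount w n) (peakSum w n)
    where w = letter w'

  ∧-rearrange₁ : ∀ B c R → (B ∧ c) ∧ R ≡ c ∧ (B ∧ R)
  ∧-rearrange₁ true true R = refl
  ∧-rearrange₁ true false R = refl
  ∧-rearrange₁ false true R = refl
  ∧-rearrange₁ false false R = refl

  ∧-rearrange₂ : ∀ B c P s Q → (B ∧ c) ∧ (P ∧ (s ∧ Q)) ≡ c ∧ (s ∧ (B ∧ (P ∧ Q)))
  ∧-rearrange₂ true true P true Q = refl
  ∧-rearrange₂ true true P false Q = ∧-zeroʳ P
  ∧-rearrange₂ true false P s Q = refl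
  ∧-rearrange₂ false true P true Q = refl
  ∧-rearrange₂ false true P false Q = refl
  ∧-rearrange₂ false false P s Q = refl

  lastStep-ballot : ∀ D U n → U + D ≡ suc n → (D + 1 ≤ᵇ U + 0) ≡ (suc D + suc D ≤ᵇ suc (suc n))
  lastStep-ballot D U n eq = leqb-cong (D + 1) (U + 0) (suc D + suc D) (suc (suc n))
      (λ p → subst (suc D + suc D ≤_) eq'
               (+-monoˡ-≤ (suc D) (subst₂ _≤_ (+-comm D 1) (+-identityʳ U) p)))
      (λ q → subst₂ _≤_ (+-comm 1 D) (sym (+-identityʳ U))
               (+-cancelʳ-≤ (suc D) (suc D) U (subst (suc D + suc D ≤_) (sym eq') q)))
      where eq' : U + suc D ≡ suc (suc n)
            eq' = trans (+-suc U D) (cong suc eq)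

  peakCase-matches : ∀ B c D K M n m x k →
    (B ∧ c) ∧ ((K + ind x ≡ᵇ k) ∧ (M + (if x then suc n else 0) ≡ᵇ m)) ≡ c ∧ peakCase D k m n B x D K M
  peakCase-matches B c D K M n m false k
    rewrite +-identityʳ K | +-identityʳ M | eqb-true D D refl = ∧-rearrange₁ B c _
  peakCase-matches B c D K M n m true zero
    rewrite eqb-plus1 K zero = trans (∧-zeroʳ (B ∧ c)) (sym (∧-zeroʳ c))
  peakCase-matches B c D K M n m true (suc j)
    rewrite eqb-plus1 K (suc j) | eqb-plus M (suc n) m | eqb-true D D refl =
      ∧-rearrange₂ B c (K ≡ᵇ j) (suc n ≤ᵇ m) (M ≡ᵇ m ∸ suc n)

  ballotStat-DD-core : ∀ B D U K M n d k m x → U + D ≡ suc n →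
    (B ∧ (D + 1 ≤ᵇ U + 0)) ∧ ((D + 1 ≡ᵇ suc d) ∧ ((K + ind x ≡ᵇ k) ∧ (M + (if x then suc n else 0) ≡ᵇ m)))
    ≡ (suc d + suc d ≤ᵇ suc (suc n)) ∧ peakCase d k m n B x D K M
  ballotStat-DD-core B D U K M n d k m x eq with D ≟ d
  ... | yes refl rewrite eqb-true (D + 1) (suc D) (+-comm D 1) | lastStep-ballot D U n eq =
        peakCase-matches B (suc D + suc D ≤ᵇ suc (suc n)) D K M n m x k
  ... | no D≢d = trans (cong (λ z → (B ∧ (D + 1 ≤ᵇ U + 0)) ∧ (z ∧ peaks)) wrongD)
                       (trans (∧-zeroʳ _) (sym (trans (cong (bound ∧_) (peakCase-false x k)) (∧-zeroʳ bound))))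
    where
    bound = suc d + suc d ≤ᵇ suc (suc n)
    peaks = (K + ind x ≡ᵇ k) ∧ (M + (if x then suc n else 0) ≡ᵇ m)
    wrongD : (D + 1 ≡ᵇ suc d) ≡ false
    wrongD = eqb-false (D + 1) (suc d) (λ e → D≢d (suc-injective (trans (+-comm 1 D) e)))
    peakCase-false : ∀ x k → peakCase d k m n B x D K M ≡ false
    peakCase-false false k rewrite eqb-false D d D≢d = ∧-zeroʳ B
    peakCase-false true zero = refl
    peakCase-false true (suc j) rewrite eqb-false D d D≢d =
      trans (cong ((suc n ≤ᵇ m) ∧_) (∧-zeroʳ B)) (∧-zeroʳ _)

  ballotStat-DD : ∀ {n} d k m (v : Vec Bool n) x →
    ballotStat (suc (suc n)) (suc d) k m ((v ∷ʳ x) ∷ʳ false) ≡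
    (suc d + suc d ≤ᵇ suc (suc n)) ∧ beforeFinalD n d k m x (v ∷ʳ x)
  ballotStat-DD {n} d k m v x = trans (ballotStat-snoc (suc d) k m (v ∷ʳ x) false)
    (trans (cong (λ z → (B ∧ (D + 1 ≤ᵇ U + 0)) ∧ ((D + 1 ≡ᵇ suc d) ∧ z))
             (cong₂ _∧_ (cong (λ e → K + e ≡ᵇ k) peakAdded) (cong (λ e → M + e ≡ᵇ m) peakPosAdded)))
      (ballotStat-DD-core B D U K M n d k m x (countU+countD w (suc n))))
    where
    w = letter (v ∷ʳ x)
    B = isBallot w (suc n)
    D = countD w (suc n)
    U = countU w (suc n)
    K = peakCount w n
    M = peakSum w n
    peakAdded : newPeak (v ∷ʳ x) false ≡ ind x
    peakAdded = cong ind (trans (∧-identityʳ _) (letter-snoc-last v x))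
    peakPosAdded : newPeakPos (v ∷ʳ x) false ≡ (if x then suc n else 0)
    peakPosAdded = cong (λ b → if b then suc n else 0) (trans (∧-identityʳ _) (letter-snoc-last v x))

-- Splitting off the last letter (and, for a final D,
-- the letter before it) gives, whenever 2(d+1) ≤ n+2,
--   C(n+2,d+1) + C(n,d) = C(n+1,d+1) + C(n+1,d) + q^{n+1} C(n,d)[k-1],
-- in the notation of polynomials in q for fixed n, d, k.
module BallotRecurrence where

  open Polynomials using (shift-cong)
  open Words
  open WordSnoc
  open BoolReflection
  open GaussianProducts using (qShiftPred)
  open import Data.Nat.Solver using (module +-*-Solver)
  open +-*-Solver

  ballotCount : ℕ → ℕ → ℕ → ℕ → ℕ
  ballotCount n d k m = countWords n (ballotStat n d k m)

  countEndingU : ℕ → ℕ → ℕ → ℕ → ℕ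
  countEndingU n d k m = countWords n (λ v → ballotStat (suc n) d k m (v ∷ʳ true))

  countEndingD : ℕ → ℕ → ℕ → ℕ → ℕ
  countEndingD n d k m = countWords n (λ v → ballotStat (suc n) d k m (v ∷ʳ false))

  ballotCount-snoc : ∀ n d k m →
    ballotCount (suc n) d k m ≡ countEndingU n d k m + countEndingD n d k m
  ballotCount-snoc n d k m = countWords-snoc n (ballotStat (suc n) d k m)

  countEndingU≡ : ∀ n d k m → countEndingU n d k m ≡ ballotCount n d k m
  countEndingU≡ n d k m = countWords-cong n (ballotStat-U d k m)

  countEndingD-noD : ∀ n k m → countEndingD n 0 k m ≡ 0
  countEndingD-noD n k m = countWords-false n (ballotStat-D-noD k m)

  -- words ending in D: either …DD (no new peak) or …UD (a new peak at n+1)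
  countEndingD-rec : ∀ n d k m → suc d + suc d ≤ suc (suc n) →
    countEndingD (suc n) (suc d) k m ≡ qShiftPred (suc n) (λ j → ballotCount n d j) k m + countEndingD n d k m
  countEndingD-rec n d k m le = begin
      countWords (suc n) (λ v → ballotStat (suc (suc n)) (suc d) k m (v ∷ʳ false))
    ≡⟨ countWords-snoc n (λ v → ballotStat (suc (suc n)) (suc d) k m (v ∷ʳ false)) ⟩
      countWords n (λ v → ballotStat (suc (suc n)) (suc d) k m ((v ∷ʳ true) ∷ʳ false))
        + countWords n (λ v → ballotStat (suc (suc n)) (suc d) k m ((v ∷ʳ false) ∷ʳ false))
    ≡⟨ cong₂ _+_ (dropFinalD true) (dropFinalD false) ⟩
      countWords n (λ v → beforeFinalD n d k m true (v ∷ʳ true)) + countEndingD n d k m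
    ≡⟨ cong (_+ countEndingD n d k m) (endingUD k) ⟩
      qShiftPred (suc n) (λ j → ballotCount n d j) k m + countEndingD n d k m ∎
    where
    open ≡-Reasoning
    dropFinalD : ∀ x → countWords n (λ v → ballotStat (suc (suc n)) (suc d) k m ((v ∷ʳ x) ∷ʳ false))
                     ≡ countWords n (λ v → beforeFinalD n d k m x (v ∷ʳ x))
    dropFinalD x = countWords-cong n (λ v →
      trans (ballotStat-DD d k m v x) (cong (_∧ beforeFinalD n d k m x (v ∷ʳ x)) (leqb-true _ _ le)))
    endingUD : ∀ k → countWords n (λ v → beforeFinalD n d k m true (v ∷ʳ true))
                   ≡ qShiftPred (suc n) (λ j → ballotCount n d j) k m
    endingUD zero = countWords-false n (λ _ → refl)
    endingUD (suc j) = trans (countWords-if n (suc n ≤ᵇ m) _)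
                             (shift-cong (suc n) (countEndingU≡ n d j) m)

  ballotCount-rec : ∀ n d k m → suc d + suc d ≤ suc (suc n) →
    ballotCount (suc (suc n)) (suc d) k m + ballotCount n d k m ≡
    ballotCount (suc n) (suc d) k m + ballotCount (suc n) d k m + qShiftPred (suc n) (λ j → ballotCount n d j) k m
  ballotCount-rec n d k m le = begin
      ballotCount (suc (suc n)) (suc d) k m + c
    ≡⟨ cong (_+ c) (ballotCount-snoc (suc n) (suc d) k m) ⟩
      countEndingU (suc n) (suc d) k m + countEndingD (suc n) (suc d) k m + c
    ≡⟨ cong (_+ c) (cong₂ _+_ (countEndingU≡ (suc n) (suc d) k m) (countEndingD-rec n d k m le)) ⟩
      a + (t + e) + c
    ≡⟨ solve 4 (λ a t e c → a :+ (t :+ e) :+ c := a :+ (c :+ e) :+ t) refl a t e c ⟩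
      a + (c + e) + t
    ≡⟨ cong (λ z → a + z + t) (sym (trans (ballotCount-snoc n d k m) (cong (_+ e) (countEndingU≡ n d k m)))) ⟩
      a + ballotCount (suc n) d k m + t ∎
    where
    open ≡-Reasoning
    a = ballotCount (suc n) (suc d) k m
    c = ballotCount n d k m
    e = countEndingD n d k m
    t = qShiftPred (suc n) (λ j → ballotCount n d j) k m

  -- the only ballot word without D's is U^n, with no peaks
  ballotCount-noD : ∀ n k m → ballotCount n 0 k m ≡ ind ((0 ≡ᵇ k) ∧ (0 ≡ᵇ m))
  ballotCount-noD zero k m = refl
  ballotCount-noD (suc n) k m =
    trans (ballotCount-snoc n 0 k m)
          (trans (cong₂ _+_ (countEndingU≡ n 0 k m) (countEndingD-noD n k m))
                 (trans (+-identityʳ _) (ballotCount-noD n k m)))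

  ballotStat-bound : ∀ n d k m v → ballotStat n d k m v ≡ true → d + d ≤ n
  ballotStat-bound n d k m v e =
    subst₂ _≤_ (cong₂ _+_ #D≡d #D≡d) (countU+countD w n) (+-monoˡ-≤ (countD w n) (isBallot-last w n bal))
    where
    w = letter v
    bal = ∧-true₁ {isBallot w n} e
    #D≡d : countD w n ≡ d
    #D≡d = eqb-sound _ _ (∧-true₁ {countD w n ≡ᵇ d} (∧-true₂ {isBallot w n} e))

  ballotCount-vanish : ∀ n d k m → n < d + d → ballotCount n d k m ≡ 0
  ballotCount-vanish n d k m lt = countWords-false n none
    where
    none : ∀ v → ballotStat n d k m v ≡ false
    none v with ballotStat n d k m v in eq
    ... | true = ⊥-elim (<⇒≱ lt (ballotStat-bound n d k m v eq))
    ... | false = refl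

-- Solving the recurrence: for d ≤ u the ballot words with u U's and d D's satisfy
--   C(u+d, d) + W(u+1, d-1) = W(u, d)            (W = gaussProd, W(u+1,-1) = 0),
-- by induction on d and u, comparing the recurrence of BallotRecurrence with
-- gaussProd-rec.  Here W(u+1,d-1) plays the role of the words that violate the
-- ballot condition.
module BallotSolution where

  open Polynomials
  open GaussianProducts
  open Words
  open BoolReflection
  open BallotRecurrence
  open import Data.Nat.Solver using (module +-*-Solver)
  open +-*-Solver

  gaussProd-noD : ∀ u k m → gaussProd u 0 k m ≡ ind ((0 ≡ᵇ k) ∧ (0 ≡ᵇ m))
  gaussProd-noD u zero zero = refl
  gaussProd-noD u zero (suc m) =
    trans (sumUpTo-suc (λ i → one i * one (suc m ∸ i)) m) (sumUpTo-zero _ m (λ i → refl))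
  gaussProd-noD u (suc j) m =
    shift-zero (suc j * suc j) _ (⋆-zeroʳ (qbinom u (suc j)) (qbinom 0 (suc j)) (λ _ → refl)) m

  gaussProdPrev : ℕ → ℕ → ℕ → Poly
  gaussProdPrev u zero k m = 0
  gaussProdPrev u (suc e) k m = gaussProd (suc u) e k m

  gaussProdPrev-rec : ∀ u d k m →
    gaussProd (suc (suc u)) d k m + gaussProdPrev u d k m ≡
    gaussProd (suc u) d k m + gaussProdPrev (suc u) d k m + qShiftPred (suc (u + d)) (gaussProdPrev u d) k m
  gaussProdPrev-rec u (suc e) k m = gaussProd-rec (suc u) e k m
  gaussProdPrev-rec u zero k m = begin
      gaussProd (suc (suc u)) 0 k m + 0
    ≡⟨ +-identityʳ _ ⟩
      gaussProd (suc (suc u)) 0 k m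
    ≡⟨ trans (gaussProd-noD (suc (suc u)) k m) (sym (gaussProd-noD (suc u) k m)) ⟩
      gaussProd (suc u) 0 k m
    ≡⟨ sym (trans (cong (_+ shifted k) (+-identityʳ _)) (noShiftedTerm k)) ⟩
      gaussProd (suc u) 0 k m + 0 + shifted k ∎
    where
    open ≡-Reasoning
    shifted : ℕ → ℕ
    shifted k = qShiftPred (suc (u + 0)) (gaussProdPrev u 0) k m
    noShiftedTerm : ∀ k → gaussProd (suc u) 0 k m + shifted k ≡ gaussProd (suc u) 0 k m
    noShiftedTerm zero = +-identityʳ _
    noShiftedTerm (suc j) =
      trans (cong (gaussProd (suc u) 0 (suc j) m +_) (shift-zero (suc (u + 0)) (λ _ → 0) (λ _ → refl) m))
            (+-identityʳ _)

  -- The linear algebra of the inductive step: from the ballot recurrence, the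
  -- two Gaussian recurrences and four instances of the invariant c + w = W,
  -- cancel c₀ + w₀ to get the invariant for the new pair (X, G).
  combine-recurrences : ∀ X G c₀ c₁ c₂ t w₀ w₁ W₀ W₁ W₂ tw tW Wgoal →
    X + c₀ ≡ c₂ + c₁ + t → c₀ + w₀ ≡ W₀ → c₁ + w₁ ≡ W₁ → c₂ + W₁ ≡ W₂ → t + tw ≡ tW →
    Wgoal + W₀ ≡ W₂ + W₁ + tW → G + w₀ ≡ W₁ + w₁ + tw → X + G ≡ Wgoal
  combine-recurrences X G c₀ c₁ c₂ t w₀ w₁ W₀ W₁ W₂ tw tW Wgoal rec₀ inv₀ inv₁ inv₂ invT recW recG =
    +-cancelʳ-≡ (c₀ + w₀) (X + G) Wgoal (begin
      X + G + (c₀ + w₀)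
    ≡⟨ +-interchange X G c₀ w₀ ⟩
      (X + c₀) + (G + w₀)
    ≡⟨ cong₂ _+_ rec₀ recG ⟩
      (c₂ + c₁ + t) + (W₁ + w₁ + tw)
    ≡⟨ solve 6 (λ c₂ c₁ t W₁ w₁ tw → (c₂ :+ c₁ :+ t) :+ (W₁ :+ w₁ :+ tw)
                                  := (c₂ :+ W₁) :+ (c₁ :+ w₁) :+ (t :+ tw)) refl c₂ c₁ t W₁ w₁ tw ⟩
      (c₂ + W₁) + (c₁ + w₁) + (t + tw)
    ≡⟨ cong₂ _+_ (cong₂ _+_ inv₂ inv₁) invT ⟩
      W₂ + W₁ + tW
    ≡⟨ sym recW ⟩
      Wgoal + W₀
    ≡⟨ cong (Wgoal +_) (sym inv₀) ⟩
      Wgoal + (c₀ + w₀) ∎)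
    where open ≡-Reasoning

  ballotCount+gaussProdPrev : ∀ d u → d ≤ u → ∀ k m →
    ballotCount (u + d) d k m + gaussProdPrev u d k m ≡ gaussProd u d k m
  ballotCount+gaussProdPrev zero u _ k m =
    trans (+-identityʳ _) (trans (cong (λ z → ballotCount z 0 k m) (+-identityʳ u))
                                 (trans (ballotCount-noD u k m) (sym (gaussProd-noD u k m))))
  ballotCount+gaussProdPrev (suc d) (suc u) (s≤s d≤u) k m =
    combine-recurrences
      (ballotCount (suc u + suc d) (suc d) k m) (gaussProd (suc (suc u)) d k m)
      (ballotCount (u + d) d k m) (ballotCount (suc u + d) d k m) (ballotCount N (suc d) k m)
      (qShiftPred N (λ j → ballotCount (u + d) d j) k m)
      (gaussProdPrev u d k m) (gaussProdPrev (suc u) d k m)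
      (gaussProd u d k m) (gaussProd (suc u) d k m) (gaussProd u (suc d) k m)
      (qShiftPred N (gaussProdPrev u d) k m) (qShiftPred N (gaussProd u d) k m)
      (gaussProd (suc u) (suc d) k m)
      ballotRec
      (ballotCount+gaussProdPrev d u d≤u k m)
      (ballotCount+gaussProdPrev d (suc u) (m≤n⇒m≤1+n d≤u) k m)
      (trans (cong (λ z → ballotCount z (suc d) k m + gaussProd (suc u) d k m) (sym lengths)) moreD)
      (qShiftPred-+ N (λ j → ballotCount (u + d) d j) (gaussProdPrev u d) (gaussProd u d)
                    (λ j i → ballotCount+gaussProdPrev d u d≤u j i) k m)
      gaussRec
      (gaussProdPrev-rec u d k m)
    where
    N = suc (u + d)
    lengths : u + suc d ≡ N
    lengths = +-suc u d
    gaussRec : gaussProd (suc u) (suc d) k m + gaussProd u d k m ≡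
               gaussProd u (suc d) k m + gaussProd (suc u) d k m + qShiftPred N (gaussProd u d) k m
    gaussRec = trans (gaussProd-rec u d k m)
      (cong (λ z → gaussProd u (suc d) k m + gaussProd (suc u) d k m + qShiftPred z (gaussProd u d) k m) lengths)
    ballotRec : ballotCount (suc u + suc d) (suc d) k m + ballotCount (u + d) d k m ≡
                ballotCount N (suc d) k m + ballotCount (suc u + d) d k m
                  + qShiftPred N (λ j → ballotCount (u + d) d j) k m
    ballotRec = trans (cong (λ z → ballotCount z (suc d) k m + ballotCount (u + d) d k m) (cong suc lengths))
      (ballotCount-rec (u + d) d k m (s≤s (subst (_≤ suc (u + d)) (sym (+-suc d d)) (s≤s (+-monoˡ-≤ d d≤u)))))
    -- the invariant for (d+1, u); when u = d there are too many D's and W is symmetric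
    moreD : ballotCount (u + suc d) (suc d) k m + gaussProd (suc u) d k m ≡ gaussProd u (suc d) k m
    moreD with suc d ≤? u
    ... | yes d<u = ballotCount+gaussProdPrev (suc d) u d<u k m
    ... | no d≮u with ≤-antisym d≤u (≮⇒≥ d≮u)
    ...   | refl = trans (cong (_+ gaussProd (suc d) d k m) (ballotCount-vanish (d + suc d) (suc d) k m ≤-refl))
                         (gaussProd-sym (suc d) d k m)

-- Split by the number d ≤ ⌊n/2⌋ of D's and telescope with ballotCount+gaussProdPrev.
module BallotTheorem where

  open GaussianProducts
  open Words
  open WordSnoc
  open BoolReflection
  open BallotRecurrence
  open BallotSolution

  ballotWordCount : ℕ → ℕ → ℕ → ℕ
  ballotWordCount n k m = countWords n (λ v →
    isBallot (letter v) n ∧ ((peakCount (letter v) (pred n) ≡ᵇ k) ∧ (peakSum (letter v) (pred n) ≡ᵇ m)))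

  <ᵇ-suc-≡ : ∀ a b P → ((a <ᵇ suc b) ∧ P) ∧ (a ≡ᵇ b) ≡ (a ≡ᵇ b) ∧ P
  <ᵇ-suc-≡ zero zero P = ∧-identityʳ P
  <ᵇ-suc-≡ zero (suc b) P = ∧-zeroʳ P
  <ᵇ-suc-≡ (suc a) zero P = refl
  <ᵇ-suc-≡ (suc a) (suc b) P = <ᵇ-suc-≡ a b P

  <ᵇ-suc-≢ : ∀ a b P → ((a <ᵇ suc b) ∧ P) ∧ not (a ≡ᵇ b) ≡ (a <ᵇ b) ∧ P
  <ᵇ-suc-≢ zero zero P = ∧-zeroʳ P
  <ᵇ-suc-≢ zero (suc b) P = ∧-identityʳ P
  <ᵇ-suc-≢ (suc a) zero P = refl
  <ᵇ-suc-≢ (suc a) (suc b) P = <ᵇ-suc-≢ a b P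

  countWords-byValue : ∀ n (P : Vec Bool n → Bool) (f : Vec Bool n → ℕ) N →
    countWords n (λ v → (f v <ᵇ N) ∧ P v) ≡ sumTo (λ d → countWords n (λ v → (f v ≡ᵇ d) ∧ P v)) N
  countWords-byValue n P f zero = countWords-false n (λ v → refl)
  countWords-byValue n P f (suc N) = begin
      countWords n (λ v → (f v <ᵇ suc N) ∧ P v)
    ≡⟨ countWords-split n (λ v → (f v <ᵇ suc N) ∧ P v) (λ v → f v ≡ᵇ N) ⟩
      countWords n (λ v → ((f v <ᵇ suc N) ∧ P v) ∧ (f v ≡ᵇ N))
        + countWords n (λ v → ((f v <ᵇ suc N) ∧ P v) ∧ not (f v ≡ᵇ N))
    ≡⟨ cong₂ _+_ (countWords-cong n (λ v → <ᵇ-suc-≡ (f v) N (P v)))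
                 (countWords-cong n (λ v → <ᵇ-suc-≢ (f v) N (P v))) ⟩
      countWords n (λ v → (f v ≡ᵇ N) ∧ P v) + countWords n (λ v → (f v <ᵇ N) ∧ P v)
    ≡⟨ +-comm (countWords n (λ v → (f v ≡ᵇ N) ∧ P v)) _ ⟩
      countWords n (λ v → (f v <ᵇ N) ∧ P v) + countWords n (λ v → (f v ≡ᵇ N) ∧ P v)
    ≡⟨ cong (_+ countWords n (λ v → (f v ≡ᵇ N) ∧ P v)) (countWords-byValue n P f N) ⟩
      sumTo (λ d → countWords n (λ v → (f v ≡ᵇ d) ∧ P v)) (suc N) ∎
    where open ≡-Reasoning

  ∧-swap : ∀ a b c → a ∧ (b ∧ c) ≡ b ∧ (a ∧ c)
  ∧-swap true b c = refl
  ∧-swap false true c = refl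
  ∧-swap false false c = refl

  ballotWordCount-byD : ∀ n k m → ballotWordCount n k m ≡ sumTo (λ d → ballotCount n d k m) (suc n)
  ballotWordCount-byD n k m =
    trans (countWords-cong n (λ v → sym (cong (_∧ R v) (leqb-true (suc (#D v)) (suc n) (s≤s (#D≤n v))))))
      (trans (countWords-byValue n R #D (suc n))
        (sumTo-congL (suc n) (λ d _ → countWords-cong n (λ v →
           ∧-swap (#D v ≡ᵇ d) (isBallot (letter v) n)
                  ((peakCount (letter v) (pred n) ≡ᵇ k) ∧ (peakSum (letter v) (pred n) ≡ᵇ m))))))
    where
    R : Vec Bool n → Bool
    R v = isBallot (letter v) n ∧ ((peakCount (letter v) (pred n) ≡ᵇ k) ∧ (peakSum (letter v) (pred n) ≡ᵇ m))
    #D : Vec Bool n → ℕ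
    #D v = countD (letter v) n
    #D≤n : ∀ v → #D v ≤ n
    #D≤n v = subst (#D v ≤_) (countU+countD (letter v) n) (m≤n+m (#D v) (countU (letter v) n))

  sumTo-tail : ∀ f a b → (∀ i → a ≤ i → f i ≡ 0) → sumTo f (a + b) ≡ sumTo f a
  sumTo-tail f a zero z = cong (sumTo f) (+-identityʳ a)
  sumTo-tail f a (suc b) z =
    trans (cong (sumTo f) (+-suc a b))
          (trans (cong₂ _+_ (sumTo-tail f a b z) (z (a + b) (m≤m+n a b))) (+-identityʳ _))

  half-< : ∀ n d → ⌊ n /2⌋ < d → n < d + d
  half-< zero (suc d) _ = s≤s z≤n
  half-< (suc zero) (suc d) _ = s≤s (subst (0 <_) (sym (+-suc d d)) (s≤s z≤n))
  half-< (suc (suc n)) (suc (suc d)) (s≤s lt) =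
    subst (suc (suc (suc n)) ≤_) (sym (+-suc (suc (suc d)) (suc d))) (s≤s (s≤s (half-< n (suc d) lt)))

  ballotCount-telescope : ∀ D u → D ≤ u → ∀ k m →
    sumTo (λ d → ballotCount (u + D) d k m) (suc D) ≡ gaussProd u D k m
  ballotCount-telescope zero u _ k m = trans (sym (+-identityʳ _)) (ballotCount+gaussProdPrev zero u z≤n k m)
  ballotCount-telescope (suc D) u le k m = begin
      sumTo (λ d → ballotCount (u + suc D) d k m) (suc D) + ballotCount (u + suc D) (suc D) k m
    ≡⟨ cong (_+ ballotCount (u + suc D) (suc D) k m) earlier ⟩
      gaussProd (suc u) D k m + ballotCount (u + suc D) (suc D) k m
    ≡⟨ +-comm (gaussProd (suc u) D k m) _ ⟩
      ballotCount (u + suc D) (suc D) k m + gaussProdPrev u (suc D) k m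
    ≡⟨ ballotCount+gaussProdPrev (suc D) u le k m ⟩
      gaussProd u (suc D) k m ∎
    where
    open ≡-Reasoning
    earlier : sumTo (λ d → ballotCount (u + suc D) d k m) (suc D) ≡ gaussProd (suc u) D k m
    earlier = trans (sumTo-congL (suc D) (λ d _ → cong (λ z → ballotCount z d k m) (+-suc u D)))
                    (ballotCount-telescope D (suc u) (≤-trans (n≤1+n D) (m≤n⇒m≤1+n le)) k m)

  ballotWordCount≡gaussProd : ∀ n k m → ballotWordCount n k m ≡ gaussProd ⌈ n /2⌉ ⌊ n /2⌋ k m
  ballotWordCount≡gaussProd n k m = begin
      ballotWordCount n k m
    ≡⟨ ballotWordCount-byD n k m ⟩
      sumTo C (suc n)
    ≡⟨ cong (sumTo C) (sym (m+[n∸m]≡n {suc ⌊ n /2⌋} (s≤s (⌊n/2⌋≤n n)))) ⟩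
      sumTo C (suc ⌊ n /2⌋ + (suc n ∸ suc ⌊ n /2⌋))
    ≡⟨ sumTo-tail C (suc ⌊ n /2⌋) _ (λ d le → ballotCount-vanish n d k m (half-< n d le)) ⟩
      sumTo C (suc ⌊ n /2⌋)
    ≡⟨ sumTo-congL (suc ⌊ n /2⌋) (λ d _ → cong (λ z → ballotCount z d k m) (sym halves)) ⟩
      sumTo (λ d → ballotCount (⌈ n /2⌉ + ⌊ n /2⌋) d k m) (suc ⌊ n /2⌋)
    ≡⟨ ballotCount-telescope ⌊ n /2⌋ ⌈ n /2⌉ (⌊n/2⌋≤⌈n/2⌉ n) k m ⟩
      gaussProd ⌈ n /2⌉ ⌊ n /2⌋ k m ∎
    where
    open ≡-Reasoning
    C = λ d → ballotCount n d k m
    halves : ⌈ n /2⌉ + ⌊ n /2⌋ ≡ n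
    halves = trans (+-comm ⌈ n /2⌉ ⌊ n /2⌋) (⌊n/2⌋+⌈n/2⌉≡n n)

-- The counter R(n) = 0, R(j) = R(j+1) + 1 after a D and
-- R(j) = R(j+1) - 1 after a U recovers, from the word alone, how many arcs
-- of the involution pass over position j (Encoding.counter≡arcsOver).
module ArcCounter where

  open Words
  open WordSnoc using (isBallot-last)
  open BoolReflection

  sumTo-+ : ∀ f g N → sumTo (λ i → f i + g i) N ≡ sumTo f N + sumTo g N
  sumTo-+ f g zero = refl
  sumTo-+ f g (suc N) =
    trans (cong (_+ (f N + g N)) (sumTo-+ f g N)) (+-interchange (sumTo f N) (sumTo g N) (f N) (g N))

  sumTo-zero : ∀ f N → (∀ i → i < N → f i ≡ 0) → sumTo f N ≡ 0
  sumTo-zero f zero z = refl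
  sumTo-zero f (suc N) z = cong₂ _+_ (sumTo-zero f N (λ i i<N → z i (m<n⇒m<1+n i<N))) (z N ≤-refl)

  ind-≤-split : ∀ j a → ind (j ≤ᵇ a) ≡ ind (suc j ≤ᵇ a) + ind (a ≡ᵇ j)
  ind-≤-split j a with <-cmp j a
  ... | tri< j<a j≢a _
    rewrite leqb-true j a (<⇒≤ j<a) | leqb-true (suc j) a j<a | eqb-false a j (λ e → j≢a (sym e)) = refl
  ... | tri≈ _ refl _
    rewrite leqb-true j j ≤-refl | leqb-false (suc j) j (λ p → n≮n j p) | eqb-true j j refl = refl
  ... | tri> _ j≢a a<j
    rewrite leqb-false j a (<⇒≱ a<j) | leqb-false (suc j) a (λ p → <⇒≱ a<j (<⇒≤ p))
          | eqb-false a j (λ e → j≢a (sym e)) = refl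

  sumTo-indicator : ∀ x j → sumTo (λ i → ind (i ≡ᵇ x)) j ≡ ind (x <ᵇ j)
  sumTo-indicator x zero = empty x
    where empty : ∀ x → 0 ≡ ind (x <ᵇ 0)
          empty zero = refl
          empty (suc x) = refl
  sumTo-indicator x (suc j) rewrite sumTo-indicator x j = step x j
    where
    step : ∀ x j → ind (x <ᵇ j) + ind (j ≡ᵇ x) ≡ ind (x <ᵇ suc j)
    step zero zero = refl
    step zero (suc j) = refl
    step (suc x) zero = refl
    step (suc x) (suc j) = step x j

  counterStep : Bool → ℕ → ℕ
  counterStep false r = suc r
  counterStep true r = pred r

  counterFrom : (ℕ → Bool) → ℕ → ℕ → ℕ
  counterFrom b j zero = 0
  counterFrom b j (suc t) = counterStep (b j) (counterFrom b (suc j) t)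

  counter : (ℕ → Bool) → ℕ → ℕ → ℕ
  counter b n j = counterFrom b j (n ∸ j)

  counter-end : ∀ b n → counter b n n ≡ 0
  counter-end b n rewrite n∸n≡0 n = refl

  counter-step : ∀ b n j → j < n → counter b n j ≡ counterStep (b j) (counter b n (suc j))
  counter-step b n j j<n rewrite +-∸-assoc 1 j<n = refl

  counterFrom-cong : ∀ b b' j t → (∀ i → j ≤ i → i < j + t → b i ≡ b' i) →
                     counterFrom b j t ≡ counterFrom b' j t
  counterFrom-cong b b' j zero e = refl
  counterFrom-cong b b' j (suc t) e = cong₂ counterStep (e j ≤-refl (m<m+n j (s≤s z≤n)))
    (counterFrom-cong b b' (suc j) t
      (λ i sj≤i i<sjt → e i (≤-trans (n≤1+n j) sj≤i) (subst (i <_) (sym (+-suc j t)) i<sjt)))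

  isBallot-prefix : ∀ w N → isBallot w N ≡ true → ∀ j → j ≤ N → countD w j ≤ countU w j
  isBallot-prefix w zero e zero z≤n = z≤n
  isBallot-prefix w (suc N) e j j≤sN with m≤n⇒m<n∨m≡n j≤sN
  ... | inj₁ (s≤s j≤N) = isBallot-prefix w N (∧-true₁ {isBallot w N} e) j j≤N
  ... | inj₂ refl = isBallot-last w (suc N) e

  isBallot-intro : ∀ w N → (∀ j → j ≤ N → countD w j ≤ countU w j) → isBallot w N ≡ true
  isBallot-intro w zero h = refl
  isBallot-intro w (suc N) h rewrite isBallot-intro w N (λ j j≤N → h j (m≤n⇒m≤1+n j≤N)) =
    leqb-true _ _ (h (suc N) ≤-refl)

-- The encoding of an involution g of {0,…,n-1} (as a function ℕ → ℕ) by the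
-- word b(i) = [i ≤ g i]: U at openers and fixed points, D at closers.
module Encoding where

  open Words
  open BoolReflection
  open ArcCounter

  record Is321Involution (n : ℕ) (g : ℕ → ℕ) : Set where
    field
      bounded : ∀ i → i < n → g i < n
      involutive : ∀ i → i < n → g (g i) ≡ i
      avoids : ∀ i j l → i < j → j < l → l < n → g j < g i → g l < g j → ⊥

  openerWord : (ℕ → ℕ) → ℕ → Bool
  openerWord g i = i ≤ᵇ g i

  module OfInvolution {n g} (V : Is321Involution n g) where
    open Is321Involution V
    b = openerWord g

    g-injective : ∀ i j → i < n → j < n → g i ≡ g j → i ≡ j
    g-injective i j i<n j<n e = trans (sym (involutive i i<n)) (trans (cong g e) (involutive j j<n))

    -- arcs from before j that end at or after j, resp. strictly after j
    arcsOver : ℕ → ℕ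
    arcsOver j = sumTo (λ i → ind (j ≤ᵇ g i)) j

    arcsAcross : ℕ → ℕ
    arcsAcross j = sumTo (λ i → ind (suc j ≤ᵇ g i)) j

    -- the difference is the arc closing at j, if any
    arcsOver-split : ∀ j → j < n → arcsOver j ≡ arcsAcross j + ind (g j <ᵇ j)
    arcsOver-split j j<n = begin
        arcsOver j
      ≡⟨ sumTo-congL j (λ i _ → ind-≤-split j (g i)) ⟩
        sumTo (λ i → ind (suc j ≤ᵇ g i) + ind (g i ≡ᵇ j)) j
      ≡⟨ sumTo-+ _ _ j ⟩
        arcsAcross j + sumTo (λ i → ind (g i ≡ᵇ j)) j
      ≡⟨ cong (arcsAcross j +_) (trans (sumTo-congL j (λ i i<j → cong ind (partner i i<j)))
                                       (sumTo-indicator (g j) j)) ⟩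
        arcsAcross j + ind (g j <ᵇ j) ∎
      where
      open ≡-Reasoning
      partner : ∀ i → i < j → (g i ≡ᵇ j) ≡ (i ≡ᵇ g j)
      partner i i<j with g i ≟ j
      ... | yes e = trans (eqb-true _ _ e)
                          (sym (eqb-true _ _ (trans (sym (involutive i (<-trans i<j j<n))) (cong g e))))
      ... | no ne = trans (eqb-false _ _ ne)
                          (sym (eqb-false _ _ (λ e → ne (trans (cong g e) (involutive j j<n)))))

    -- no arc passes over a fixed point (it would form a 321 pattern)
    arcsAcross-fixed : ∀ j → j < n → g j ≡ j → arcsAcross j ≡ 0
    arcsAcross-fixed j j<n gj = sumTo-zero _ j none
      where
      none : ∀ i → i < j → ind (suc j ≤ᵇ g i) ≡ 0
      none i i<j with suc j ≤? g i
      ... | no p = cong ind (leqb-false _ _ p)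
      ... | yes p = ⊥-elim (avoids i j (g i) i<j p (bounded i i<n) (subst (_< g i) (sym gj) p)
                                   (subst (_< g j) (sym (involutive i i<n)) (subst (i <_) (sym gj) i<j)))
        where i<n = <-trans i<j j<n

    before-end : ∀ {j t} → j + suc t ≡ n → j < n
    before-end {j} e = subst (j <_) e (m<m+n j (s≤s z≤n))

    counterFrom≡arcsOver : ∀ t j → j + t ≡ n → counterFrom b j t ≡ arcsOver j
    counterFrom≡arcsOver zero j e = sym (sumTo-zero _ j (λ i i<j → cong ind (leqb-false j (g i)
        (λ p → <⇒≱ (bounded i (subst (i <_) j≡n i<j)) (subst (_≤ g i) j≡n p)))))
      where j≡n : j ≡ n
            j≡n = trans (sym (+-identityʳ j)) e
    counterFrom≡arcsOver (suc t) j e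
      rewrite counterFrom≡arcsOver t (suc j) (trans (sym (+-suc j t)) e) with <-cmp (g j) j
    -- a closer: one more arc over j than just after it
    ... | tri< gj<j _ _
      rewrite leqb-false j (g j) (<⇒≱ gj<j) | leqb-false (suc j) (g j) (λ p → <⇒≱ gj<j (<⇒≤ p)) =
        sym (trans (arcsOver-split j (before-end e))
                   (trans (cong (λ c → arcsAcross j + ind c) (ltb-true (g j) j gj<j))
                          (trans (+-comm (arcsAcross j) 1) (cong suc (sym (+-identityʳ (arcsAcross j)))))))
    -- a fixed point: no arcs on either side
    ... | tri≈ _ gj≡j _
      rewrite leqb-true j (g j) (≤-reflexive (sym gj≡j))
            | leqb-false (suc j) (g j) (λ p → n≮n j (subst (j <_) gj≡j p)) =
        trans (cong pred (trans (+-identityʳ (arcsAcross j)) (arcsAcross-fixed j (before-end e) gj≡j)))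
              (sym (trans (arcsOver-split j (before-end e))
                          (cong₂ _+_ (arcsAcross-fixed j (before-end e) gj≡j)
                                     (cong ind (ltb-false (g j) j (λ p → n≮n j (subst (_< j) gj≡j p)))))))
    -- an opener: one arc fewer over j than just after it
    ... | tri> _ _ j<gj
      rewrite leqb-true j (g j) (<⇒≤ j<gj) | leqb-true (suc j) (g j) j<gj =
        trans (cong pred (+-comm (arcsAcross j) 1))
              (sym (trans (arcsOver-split j (before-end e))
                          (trans (cong (λ c → arcsAcross j + ind c) (ltb-false (g j) j (<-asym j<gj)))
                                 (+-identityʳ _))))

    counter≡arcsOver : ∀ j → j ≤ n → counter b n j ≡ arcsOver j
    counter≡arcsOver j j≤n = counterFrom≡arcsOver (n ∸ j) j (m+[n∸m]≡n j≤n)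

    fixed⇒counter : ∀ i → i < n → g i ≡ i → (b i ≡ true) × (counter b n (suc i) ≡ 0)
    fixed⇒counter i i<n gi = leqb-true i (g i) (≤-reflexive (sym gi)) ,
      trans (counter≡arcsOver (suc i) i<n)
            (cong₂ _+_ (arcsAcross-fixed i i<n gi)
                       (cong ind (leqb-false (suc i) (g i) (λ p → n≮n i (subst (i <_) gi p)))))

    counter⇒fixed : ∀ i → i < n → b i ≡ true → counter b n (suc i) ≡ 0 → g i ≡ i
    counter⇒fixed i i<n bi r with m≤n⇒m<n∨m≡n (leqb-sound i (g i) bi)
    ... | inj₂ e = sym e
    ... | inj₁ lt = ⊥-elim (<⇒≱ (subst (1 ≤_) (trans (sym (counter≡arcsOver (suc i) i<n)) r) ownArc) ≤-refl)
      where
      -- the arc opened at i passes over i+1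
      ownArc : 1 ≤ arcsOver (suc i)
      ownArc = subst (λ z → 1 ≤ arcsAcross i + z) (sym (cong ind (leqb-true (suc i) (g i) lt)))
                     (m≤n+m 1 (arcsAcross i))

    openers-increasing : ∀ i i' → i < i' → i' < n → i < g i → i' < g i' → g i < g i'
    openers-increasing i i' i<i' i'<n o1 o2 with <-cmp (g i) (g i')
    ... | tri< p _ _ = p
    ... | tri≈ _ e _ = ⊥-elim (<-irrefl (g-injective i i' (<-trans i<i' i'<n) i'<n e) i<i')
    ... | tri> _ _ p = ⊥-elim (avoids i i' (g i') i<i' o2 (bounded i' i'<n) p
                                      (subst (_< g i') (sym (involutive i' i'<n)) o2))

    descent≡peak : ∀ i → suc i < n → (g (suc i) <ᵇ g i) ≡ peak b i
    descent≡peak i si<n with i ≤? g i | suc i ≤? g (suc i)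
    ... | yes p | no q rewrite leqb-true i (g i) p | leqb-false (suc i) (g (suc i)) q =
          ltb-true _ _ (≤∧≢⇒< (≤-trans (≤-pred (≰⇒> q)) p)
                              (λ e → n≮n i (subst (i <_) (g-injective (suc i) i si<n i<n e) (n<1+n i))))
      where i<n = <-trans (n<1+n i) si<n
    ... | no p | _ rewrite leqb-false i (g i) p = ltb-false _ _ noDescent
      where
      i<n = <-trans (n<1+n i) si<n
      noDescent : ¬ (g (suc i) < g i)
      noDescent lt = avoids (g (suc i)) (g i) (suc i) lt (<-trans (≰⇒> p) (n<1+n i)) si<n
                (subst₂ _<_ (sym (involutive i i<n)) (sym (involutive (suc i) si<n)) (n<1+n i))
                (subst (g (suc i) <_) (sym (involutive i i<n)) (<-trans lt (≰⇒> p)))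
    ... | yes p | yes q rewrite leqb-true i (g i) p | leqb-true (suc i) (g (suc i)) q = ltb-false _ _ noDescent
      where
      i<n = <-trans (n<1+n i) si<n
      noDescent : ¬ (g (suc i) < g i)
      noDescent lt with m≤n⇒m<n∨m≡n q
      ... | inj₂ e = avoids i (suc i) (g i) (n<1+n i) (subst (_< g i) (sym e) lt) (bounded i i<n) lt
                       (subst₂ _<_ (sym (involutive i i<n)) e (n<1+n i))
      ... | inj₁ sl = avoids i (suc i) (g (suc i)) (n<1+n i) sl (bounded (suc i) si<n) lt
                       (subst (_< g (suc i)) (sym (involutive (suc i) si<n)) sl)

    ballot-invariant : ∀ j → j ≤ n → countD b j + arcsOver j ≤ countU b j
    ballot-invariant zero _ = z≤n
    ballot-invariant (suc j) sj≤n
      with ballot-invariant j (≤-trans (n≤1+n j) sj≤n) | arcsOver-split j sj≤n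
    ... | ih | split with <-cmp (g j) j
    ...   | tri< gj<j _ _
      rewrite leqb-false j (g j) (<⇒≱ gj<j) | leqb-false (suc j) (g j) (λ p → <⇒≱ gj<j (<⇒≤ p))
            | ltb-true (g j) j gj<j =
        subst (_≤ countU b j + 0) (sym (shuffle (countD b j) (arcsAcross j)))
              (subst (countD b j + (arcsAcross j + 1) ≤_) (sym (+-identityʳ _))
                     (subst (λ z → countD b j + z ≤ countU b j) split ih))
      where shuffle : ∀ c x → c + 1 + (x + 0) ≡ c + (x + 1)
            shuffle c x = trans (cong (c + 1 +_) (+-identityʳ x))
                                (trans (+-assoc c 1 x) (cong (c +_) (+-comm 1 x)))
    ...   | tri≈ _ gj≡j _
      rewrite leqb-true j (g j) (≤-reflexive (sym gj≡j))
            | leqb-false (suc j) (g j) (λ p → n≮n j (subst (j <_) gj≡j p))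
            | ltb-false (g j) j (λ p → n≮n j (subst (_< j) gj≡j p)) =
        ≤-trans (≤-reflexive (cong (_+ (arcsAcross j + 0)) (+-identityʳ (countD b j))))
                (≤-trans (subst (λ z → countD b j + z ≤ countU b j) split ih) (m≤m+n (countU b j) 1))
    ...   | tri> _ _ j<gj
      rewrite leqb-true j (g j) (<⇒≤ j<gj) | leqb-true (suc j) (g j) j<gj
            | ltb-false (g j) j (λ p → <⇒≱ j<gj (<⇒≤ p)) =
        subst₂ _≤_ (shuffle (countD b j) (arcsAcross j)) refl
               (+-monoˡ-≤ 1 (subst (λ z → countD b j + z ≤ countU b j) split ih))
      where shuffle : ∀ c x → c + (x + 0) + 1 ≡ c + 0 + (x + 1)
            shuffle c x = trans (+-assoc c (x + 0) 1)
                                (trans (cong (λ z → c + (z + 1)) (+-identityʳ x))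
                                       (cong (_+ (x + 1)) (sym (+-identityʳ c))))

    openerWord-ballot : isBallot b n ≡ true
    openerWord-ballot = isBallot-intro b n (λ j j≤n →
      ≤-trans (m≤m+n (countD b j) (arcsOver j)) (ballot-invariant j j≤n))

-- By
-- strong induction on i: fixed points are read off from the word and its
-- arc counter, a closer i is matched by an earlier position, and for an
-- opener i the partners cannot differ because arcs do not nest.
module EncodingInjective where

  open BoolReflection
  open ArcCounter
  open Encoding

  module _ {n g h} (Vg : Is321Involution n g) (Vh : Is321Involution n h)
           (same : ∀ i → i < n → openerWord g i ≡ openerWord h i) where
    private
      module G = OfInvolution Vg
      module H = OfInvolution Vh
      open Is321Involution

    sameCounter : ∀ j → j ≤ n → counter (openerWord g) n j ≡ counter (openerWord h) n j
    sameCounter j j≤n =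
      counterFrom-cong _ _ j (n ∸ j) (λ i _ i<jt → same i (subst (i <_) (m+[n∸m]≡n j≤n) i<jt))

    fixed-same : ∀ i → i < n → g i ≡ i → h i ≡ i
    fixed-same i i<n gi with G.fixed⇒counter i i<n gi
    ... | bi , r = H.counter⇒fixed i i<n (trans (sym (same i i<n)) bi) (trans (sym (sameCounter (suc i) i<n)) r)

    earlier-partner : ∀ i → i < n → (∀ o → o < i → g o ≡ h o) → i < g i → i < h i → g i < h i → ⊥
    earlier-partner i i<n agree open-g open-h gi<hi = refute (h j) (involutive Vh j j<n) (bounded Vh j j<n) hj<j
      where
      j = g i
      j<n = bounded Vg i i<n
      gj<j : g j < j
      gj<j = subst (_< j) (sym (involutive Vg i i<n)) open-g
      -- j is a closer of g, hence of h
      hj<j : h j < j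
      hj<j with j ≤? h j
      ... | no p = ≰⇒> p
      ... | yes p = ⊥-elim (<⇒≱ gj<j (leqb-sound j (g j) (trans (same j j<n) (leqb-true j (h j) p))))
      -- the h-partner i' of j can be neither i, nor before i, nor after i
      refute : ∀ i' → h i' ≡ j → i' < n → i' < j → ⊥
      refute i' hi'≡j i'<n i'<j with <-cmp i' i
      ... | tri≈ _ e _ = <-irrefl (trans (sym hi'≡j) (cong h e)) gi<hi
      ... | tri< p _ _ = <-irrefl (G.g-injective i' i (<-trans p i<n) i<n (trans (agree i' p) hi'≡j)) p
      ... | tri> _ _ p = <-asym gi<hi (subst (h i <_) hi'≡j
                           (H.openers-increasing i i' p i'<n open-h (subst (i' <_) (sym hi'≡j) i'<j)))

  encoding-injective : ∀ {n g h} (Vg : Is321Involution n g) (Vh : Is321Involution n h) →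
    (∀ i → i < n → openerWord g i ≡ openerWord h i) → ∀ i → i < n → g i ≡ h i
  encoding-injective {n} {g} {h} Vg Vh same = <-rec (λ i → i < n → g i ≡ h i) step
    where
    open Is321Involution
    same' : ∀ i → i < n → openerWord h i ≡ openerWord g i
    same' i p = sym (same i p)
    -- an opener of g is an opener of h: it is a U in the word and not a fixed point of h
    opener-same : ∀ i → i < n → i < g i → i < h i
    opener-same i i<n i<gi
      with m≤n⇒m<n∨m≡n (leqb-sound i (h i) (trans (sym (same i i<n)) (leqb-true i (g i) (<⇒≤ i<gi))))
    ... | inj₁ q = q
    ... | inj₂ e = ⊥-elim (<-irrefl (sym (fixed-same Vh Vg same' i i<n (sym e))) i<gi)
    step : ∀ i → (∀ {o} → o < i → o < n → g o ≡ h o) → i < n → g i ≡ h i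
    step i IH i<n with <-cmp (g i) i
    ... | tri≈ _ e _ = trans e (sym (fixed-same Vg Vh same i i<n e))
    ... | tri< gi<i _ _ =
      trans (sym (involutive Vh (g i) gi<n)) (cong h (trans (sym (IH gi<i gi<n)) (involutive Vg i i<n)))
      where gi<n = bounded Vg i i<n
    ... | tri> _ _ i<gi with <-cmp (g i) (h i)
    ...   | tri≈ _ e _ = e
    ...   | tri< p _ _ = ⊥-elim (earlier-partner Vg Vh same i i<n (λ o o<i → IH o<i (<-trans o<i i<n))
                                                 i<gi (opener-same i i<n i<gi) p)
    ...   | tri> _ _ p = ⊥-elim (earlier-partner Vh Vg same' i i<n (λ o o<i → sym (IH o<i (<-trans o<i i<n)))
                                                 (opener-same i i<n i<gi) i<gi p)

module Search where

  open Words

  -- the first i' ∈ [i, i+t) with P i' (or i+t if there is none)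
  search : (ℕ → Bool) → ℕ → ℕ → ℕ
  search P i zero = i
  search P i (suc t) = if P i then i else search P (suc i) t

  search-finds : ∀ P t i x → i ≤ x → x < i + t → P x ≡ true →
                 (P (search P i t) ≡ true) × (search P i t < i + t)
  search-finds P zero i x i≤x x<it Px = ⊥-elim (<⇒≱ x<it (subst (_≤ x) (sym (+-identityʳ i)) i≤x))
  search-finds P (suc t) i x i≤x x<it Px with P i in eq
  ... | true = eq , m<m+n i (s≤s z≤n)
  ... | false with m≤n⇒m<n∨m≡n i≤x
  ...   | inj₂ refl = ⊥-elim (false≢true (trans (sym eq) Px))
    where false≢true : false ≡ true → ⊥
          false≢true ()
  ...   | inj₁ i<x with search-finds P t (suc i) x i<x (subst (x <_) (+-suc i t) x<it) Px
  ...     | found , bound = found , subst (search P (suc i) t <_) (sym (+-suc i t)) bound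

  countUpTo : (ℕ → Bool) → ℕ → ℕ
  countUpTo P j = sumTo (λ i → ind (P i)) j

  countUpTo-mono : ∀ P j j' → j ≤ j' → countUpTo P j ≤ countUpTo P j'
  countUpTo-mono P j j' j≤j' with m≤n⇒∃[o]m+o≡n j≤j'
  ... | o , refl = grow o
    where
    grow : ∀ o → countUpTo P j ≤ countUpTo P (j + o)
    grow zero = ≤-reflexive (cong (countUpTo P) (sym (+-identityʳ j)))
    grow (suc o) = subst (countUpTo P j ≤_) (cong (countUpTo P) (sym (+-suc j o)))
                         (≤-trans (grow o) (m≤m+n _ _))

  countUpTo-hit : ∀ P x → P x ≡ true → countUpTo P (suc x) ≡ suc (countUpTo P x)
  countUpTo-hit P x e rewrite e = +-comm (countUpTo P x) 1

  countUpTo-strict : ∀ P x y → P x ≡ true → x < y → suc (countUpTo P x) ≤ countUpTo P y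
  countUpTo-strict P x y e x<y =
    subst (_≤ countUpTo P y) (countUpTo-hit P x e) (countUpTo-mono P (suc x) y x<y)

  countUpTo-injective : ∀ P x y → P x ≡ true → P y ≡ true → countUpTo P x ≡ countUpTo P y → x ≡ y
  countUpTo-injective P x y ex ey e with <-cmp x y
  ... | tri≈ _ p _ = p
  ... | tri< p _ _ = ⊥-elim (<-irrefl e (countUpTo-strict P x y ex p))
  ... | tri> _ _ p = ⊥-elim (<-irrefl (sym e) (countUpTo-strict P y x ey p))

  countUpTo-attains : ∀ P N r → r < countUpTo P N →
                      Σ ℕ (λ x → (x < N) × ((P x ≡ true) × (countUpTo P x ≡ r)))
  countUpTo-attains P zero r ()
  countUpTo-attains P (suc N) r lt with r <? countUpTo P N
  ... | yes p with countUpTo-attains P N r p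
  ...   | x , x<N , hit = x , m<n⇒m<1+n x<N , hit
  countUpTo-attains P (suc N) r lt | no p with P N in eq
  ...   | true = N , ≤-refl , eq , ≤-antisym (≮⇒≥ p) (≤-pred (subst (r <_) (+-comm (countUpTo P N) 1) lt))
  ...   | false = ⊥-elim (p (subst (r <_) (+-identityʳ (countUpTo P N)) lt))

-- A U after which the arc counter is zero is a
-- fixed point; every other U is an opener, and the r-th opener is matched
-- with the r-th closer (D).  The counter identity
--   #openers before j = #closers before j + counter at j
-- guarantees that partners exist and lie on the correct side.
module Decoding where

  open Words
  open BoolReflection
  open ArcCounter
  open Encoding
  open Search

  not-true : ∀ {x} → not x ≡ true → x ≡ false
  not-true {false} _ = refl

  module DecodeDefs (n : ℕ) (b : ℕ → Bool) where
    ctr : ℕ → ℕ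
    ctr j = counter b n j

    isFixed isOpener isCloser : ℕ → Bool
    isFixed i = b i ∧ (ctr (suc i) ≡ᵇ 0)
    isOpener i = b i ∧ not (ctr (suc i) ≡ᵇ 0)
    isCloser i = not (b i)

    openersBefore closersBefore : ℕ → ℕ
    openersBefore = countUpTo isOpener
    closersBefore = countUpTo isCloser

    closerNo openerNo : ℕ → ℕ
    closerNo r = search (λ j → isCloser j ∧ (closersBefore j ≡ᵇ r)) 0 n
    openerNo r = search (λ i → isOpener i ∧ (openersBefore i ≡ᵇ r)) 0 n

    decode : ℕ → ℕ
    decode i = if isFixed i then i else (if b i then closerNo (openersBefore i) else openerNo (closersBefore i))

  module Decode (n : ℕ) (b : ℕ → Bool) (bal : isBallot b n ≡ true) where
    open DecodeDefs n b public

    before-end : ∀ {j t} → j + suc t ≡ n → j < n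
    before-end {j} e = subst (j <_) e (m<m+n j (s≤s z≤n))

    counter-bound : ∀ t j → j + t ≡ n → ctr j + countD b j ≤ countU b j
    counter-bound zero j e =
      subst (λ z → z + countD b j ≤ countU b j) (sym ctr≡0) (isBallot-prefix b n bal j (≤-reflexive j≡n))
      where j≡n : j ≡ n
            j≡n = trans (sym (+-identityʳ j)) e
            ctr≡0 : ctr j ≡ 0
            ctr≡0 = cong (counterFrom b j) (m≤n⇒m∸n≡0 (≤-reflexive (sym j≡n)))
    counter-bound (suc t) j e with counter-bound t (suc j) (trans (sym (+-suc j t)) e)
    ... | ih rewrite counter-step b n j (before-end e) with b j
    ...   | false = subst₂ _≤_ (shuffle (ctr (suc j)) (countD b j)) (+-identityʳ (countU b j)) ih
      where shuffle : ∀ r c → r + (c + 1) ≡ suc r + c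
            shuffle r c = trans (cong (r +_) (+-comm c 1)) (+-suc r c)
    ...   | true with ctr (suc j)
    ...     | zero = isBallot-prefix b n bal j (<⇒≤ (before-end e))
    ...     | suc r = ≤-pred (subst₂ _≤_ (cong suc (cong (r +_) (+-identityʳ (countD b j))))
                                          (+-comm (countU b j) 1) ih)

    ctr-start : ctr 0 ≡ 0
    ctr-start = n≤0⇒n≡0 (≤-trans (m≤m+n (ctr 0) 0) (counter-bound n 0 refl))

    ctr-step : ∀ j → j < n → ctr j ≡ counterStep (b j) (ctr (suc j))
    ctr-step j j<n = counter-step b n j j<n

    openers≡closers+ctr : ∀ j → j ≤ n → openersBefore j ≡ closersBefore j + ctr j
    openers≡closers+ctr zero _ = sym ctr-start
    openers≡closers+ctr (suc j) sj≤n
      with openers≡closers+ctr j (≤-trans (n≤1+n j) sj≤n) | ctr-step j sj≤n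
    ... | ih | step with b j
    ...   | false rewrite step = trans (+-identityʳ (openersBefore j)) (trans ih (shuffle (closersBefore j) (ctr (suc j))))
      where shuffle : ∀ c r → c + suc r ≡ c + 1 + r
            shuffle c r = trans (+-suc c r) (cong (_+ r) (+-comm 1 c))
    ...   | true with ctr (suc j)
    ...     | zero rewrite step =
              trans (+-identityʳ (openersBefore j)) (trans ih (cong (_+ 0) (sym (+-identityʳ (closersBefore j)))))
    ...     | suc r rewrite step =
              trans (cong (_+ 1) ih) (trans (+-assoc (closersBefore j) r 1)
                (trans (cong (closersBefore j +_) (+-comm r 1)) (cong (_+ suc r) (sym (+-identityʳ (closersBefore j))))))

    openers≡closers : openersBefore n ≡ closersBefore n
    openers≡closers =
      trans (openers≡closers+ctr n ≤-refl) (trans (cong (closersBefore n +_) (counter-end b n)) (+-identityʳ _))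

    closers≤openers : ∀ j → j ≤ n → closersBefore j ≤ openersBefore j
    closers≤openers j j≤n = subst (closersBefore j ≤_) (sym (openers≡closers+ctr j j≤n)) (m≤m+n _ _)

    data Kind (i : ℕ) : Set where
      fixedPt : isFixed i ≡ true → Kind i
      opener : isOpener i ≡ true → Kind i
      closer : b i ≡ false → Kind i

    kind : ∀ i → Kind i
    kind i with b i in eb | ctr (suc i) ≡ᵇ 0 in er
    ... | false | _ = closer eb
    ... | true | true = fixedPt (cong₂ _∧_ eb er)
    ... | true | false = opener (trans (cong (_∧ not (ctr (suc i) ≡ᵇ 0)) eb) (cong not er))

    -- at a fixed point the counter is zero, so openers and closers balance
    balanced-at-fixed : ∀ i → i < n → isFixed i ≡ true → openersBefore i ≡ closersBefore i
    balanced-at-fixed i i<n e =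
      trans (openers≡closers+ctr i (<⇒≤ i<n)) (trans (cong (closersBefore i +_) ctr≡0) (+-identityʳ _))
      where
      bi = ∧-true₁ {b i} e
      after≡0 = eqb-sound (ctr (suc i)) 0 (∧-true₂ {b i} e)
      ctr≡0 : ctr i ≡ 0
      ctr≡0 rewrite ctr-step i i<n | bi | after≡0 = refl

    decode-fixed : ∀ i → isFixed i ≡ true → decode i ≡ i
    decode-fixed i e rewrite e = refl

    decode-opener : ∀ i → isOpener i ≡ true → decode i ≡ closerNo (openersBefore i)
    decode-opener i e rewrite ∧-true₁ {b i} e | not-true (∧-true₂ {b i} e) = refl

    decode-closer : ∀ i → b i ≡ false → decode i ≡ openerNo (closersBefore i)
    decode-closer i e rewrite e = refl

    closerNo-spec : ∀ r → r < closersBefore n →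
      (isCloser (closerNo r) ≡ true) × ((closersBefore (closerNo r) ≡ r) × (closerNo r < n))
    closerNo-spec r lt with countUpTo-attains isCloser n r lt
    ... | x , x<n , px , cx
      with search-finds (λ j → isCloser j ∧ (closersBefore j ≡ᵇ r)) n 0 x z≤n x<n (cong₂ _∧_ px (eqb-true _ _ cx))
    ...   | ok , bd = ∧-true₁ {isCloser (closerNo r)} ok , eqb-sound _ _ (∧-true₂ {isCloser (closerNo r)} ok) , bd

    openerNo-spec : ∀ r → r < openersBefore n →
      (isOpener (openerNo r) ≡ true) × ((openersBefore (openerNo r) ≡ r) × (openerNo r < n))
    openerNo-spec r lt with countUpTo-attains isOpener n r lt
    ... | x , x<n , px , cx
      with search-finds (λ j → isOpener j ∧ (openersBefore j ≡ᵇ r)) n 0 x z≤n x<n (cong₂ _∧_ px (eqb-true _ _ cx))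
    ...   | ok , bd = ∧-true₁ {isOpener (openerNo r)} ok , eqb-sound _ _ (∧-true₂ {isOpener (openerNo r)} ok) , bd

    opener-U : ∀ i → isOpener i ≡ true → b i ≡ true
    opener-U i e = ∧-true₁ {b i} e

    fixed-U : ∀ i → isFixed i ≡ true → b i ≡ true
    fixed-U i e = ∧-true₁ {b i} e

    true≢false : ∀ {x} → x ≡ true → x ≡ false → ⊥
    true≢false refl ()

    record OpenerPartner (i p : ℕ) : Set where
      constructor openerPartner
      field
        closes : isCloser p ≡ true
        rank : closersBefore p ≡ openersBefore i
        bound : p < n
        later : i < p

    record CloserPartner (i p : ℕ) : Set where
      constructor closerPartner
      field
        opens : isOpener p ≡ true
        rank : openersBefore p ≡ closersBefore i
        bound : p < n
        earlier : p < i

    opener-rank< : ∀ i → i < n → isOpener i ≡ true → openersBefore i < closersBefore n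
    opener-rank< i i<n e = subst (openersBefore i <_) openers≡closers
      (subst (_≤ openersBefore n) (countUpTo-hit isOpener i e) (countUpTo-mono isOpener (suc i) n i<n))

    closer-rank< : ∀ i → i < n → b i ≡ false → closersBefore i < openersBefore n
    closer-rank< i i<n e = subst (closersBefore i <_) (sym openers≡closers)
      (subst (_≤ closersBefore n) (countUpTo-hit isCloser i (cong not e)) (countUpTo-mono isCloser (suc i) n i<n))

    opener-facts : ∀ i → i < n → isOpener i ≡ true → OpenerPartner i (decode i)
    opener-facts i i<n e rewrite decode-opener i e with closerNo-spec (openersBefore i) (opener-rank< i i<n e)
    ... | c , cc , lt = openerPartner c cc lt later
      where
      partner = closerNo (openersBefore i)
      later : i < partner
      later with <-cmp i partner
      ... | tri< p _ _ = p
      ... | tri≈ _ p _ = ⊥-elim (true≢false (opener-U i e) (subst (λ z → b z ≡ false) (sym p) (not-true c)))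
      ... | tri> _ _ p = ⊥-elim (<⇒≱ (subst (λ z → suc z ≤ closersBefore i) cc (countUpTo-strict isCloser partner i c p))
                                     (closers≤openers i (<⇒≤ i<n)))

    closer-facts : ∀ i → i < n → b i ≡ false → CloserPartner i (decode i)
    closer-facts i i<n e rewrite decode-closer i e with openerNo-spec (closersBefore i) (closer-rank< i i<n e)
    ... | c , cc , lt = closerPartner c cc lt earlier
      where
      partner = openerNo (closersBefore i)
      earlier : partner < i
      earlier with <-cmp partner i
      ... | tri< p _ _ = p
      ... | tri≈ _ p _ = ⊥-elim (true≢false (opener-U partner c) (subst (λ z → b z ≡ false) (sym p) e))
      ... | tri> _ _ p = ⊥-elim (<⇒≱ (≤-trans (subst (_≤ closersBefore (suc i)) (countUpTo-hit isCloser i (cong not e)) ≤-refl)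
                                              (≤-trans (closers≤openers (suc i) i<n) (countUpTo-mono isOpener (suc i) partner p)))
                                     (≤-reflexive cc))

    decode-bounded : ∀ i → i < n → decode i < n
    decode-bounded i i<n with kind i
    ... | fixedPt e = subst (_< n) (sym (decode-fixed i e)) i<n
    ... | opener e = OpenerPartner.bound (opener-facts i i<n e)
    ... | closer e = CloserPartner.bound (closer-facts i i<n e)

    decode-word : ∀ i → i < n → openerWord decode i ≡ b i
    decode-word i i<n with kind i
    ... | fixedPt e rewrite decode-fixed i e | fixed-U i e = leqb-true i i ≤-refl
    ... | opener e = trans (leqb-true i (decode i) (<⇒≤ (OpenerPartner.later (opener-facts i i<n e)))) (sym (opener-U i e))
    ... | closer e = trans (leqb-false i (decode i) (<⇒≱ (CloserPartner.earlier (closer-facts i i<n e)))) (sym e)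

    -- partners of partners: both have the same rank, and ranks are injective
    decode-involutive : ∀ i → i < n → decode (decode i) ≡ i
    decode-involutive i i<n with kind i
    ... | fixedPt e rewrite decode-fixed i e = decode-fixed i e
    ... | opener e with opener-facts i i<n e
    ...   | openerPartner c cc lt _ with closer-facts (decode i) lt (not-true c)
    ...     | closerPartner c' cc' _ _ = countUpTo-injective isOpener (decode (decode i)) i c' e (trans cc' cc)
    decode-involutive i i<n | closer e with closer-facts i i<n e
    ...   | closerPartner c cc lt _ with opener-facts (decode i) lt c
    ...     | openerPartner c' cc' _ _ =
              countUpTo-injective isCloser (decode (decode i)) i c' (cong not e) (trans cc' cc)

    -- a 321 pattern i < j < l would need a fixed point under an arc, or two nested arcs
    decode-avoids : ∀ i j l → i < j → j < l → l < n → decode j < decode i → decode l < decode j → ⊥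
    decode-avoids i j l i<j j<l l<n gji glj with kind j
    ... | fixedPt ej = middleFixed (kind i)
      where
      j<n = <-trans j<l l<n
      i<n = <-trans i<j j<n
      gj = decode-fixed j ej
      middleFixed : Kind i → ⊥
      middleFixed (fixedPt ei) = <-asym i<j (subst₂ _<_ gj (decode-fixed i ei) gji)
      middleFixed (closer ei) =
        <-asym (<-trans i<j (subst (_< decode i) gj gji)) (CloserPartner.earlier (closer-facts i i<n ei))
      middleFixed (opener ei) with opener-facts i i<n ei
      ... | openerPartner c cc lt _ = <-irrefl (sym (balanced-at-fixed j j<n ej))
            (≤-trans (s≤s (subst (closersBefore j ≤_) cc
                                 (countUpTo-mono isCloser j (decode i) (<⇒≤ (subst (_< decode i) gj gji)))))
                     (subst (_≤ openersBefore j) (countUpTo-hit isOpener i ei) (countUpTo-mono isOpener (suc i) j i<j)))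
    ... | opener ej with opener-facts j (<-trans j<l l<n) ej
    ...   | openerPartner cj ccj ltj gtj = middleOpener (kind i)
      where
      j<n = <-trans j<l l<n
      i<n = <-trans i<j j<n
      middleOpener : Kind i → ⊥
      middleOpener (fixedPt ei) = <-asym gji (subst (_< decode j) (sym (decode-fixed i ei)) (<-trans i<j gtj))
      middleOpener (closer ei) =
        <-asym gji (<-trans (CloserPartner.earlier (closer-facts i i<n ei)) (<-trans i<j gtj))
      middleOpener (opener ei) with opener-facts i i<n ei
      ... | openerPartner c cc lt _ =
            <⇒≱ (subst₂ _<_ (sym cc) (sym ccj) (countUpTo-strict isOpener i j ei i<j))
                (countUpTo-mono isCloser (decode j) (decode i) (<⇒≤ gji))
    decode-avoids i j l i<j j<l l<n gji glj | closer ej with closer-facts j (<-trans j<l l<n) ej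
    ...   | closerPartner cj ccj ltj gtj = middleCloser (kind l)
      where
      middleCloser : Kind l → ⊥
      middleCloser (fixedPt el) = <-asym glj (subst (decode j <_) (sym (decode-fixed l el)) (<-trans gtj j<l))
      middleCloser (opener el) =
        <-asym glj (<-trans (<-trans gtj j<l) (OpenerPartner.later (opener-facts l l<n el)))
      middleCloser (closer el) with closer-facts l l<n el
      ... | closerPartner c cc lt _ =
            <⇒≱ (subst₂ _<_ (sym ccj) (sym cc) (countUpTo-strict isCloser j l (cong not ej) j<l))
                (countUpTo-mono isOpener (decode l) (decode j) (<⇒≤ glj))

    decode-valid : Is321Involution n decode
    decode-valid = record { bounded = decode-bounded ; involutive = decode-involutive ; avoids = decode-avoids }

-- The left side of the theorem is the
-- length of a filtered list of all maps; it is compared with a count over all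
-- Boolean words by exhibiting injections in both directions between the
-- filtered lists (count-≤-injection), which needs duplicate-free lists and
-- the completeness of the enumeration allVecs.
module FiniteCounting where

  open Words using (countWords)

  data NoDup {A : Set} : List A → Set where
    [] : NoDup []
    _∷_ : ∀ {x xs} → x ∉ xs → NoDup xs → NoDup (x ∷ xs)

  unique⇒nodup : ∀ {A : Set} {xs : List A} → AllPairs (λ x y → x ≢ y) xs → NoDup xs
  unique⇒nodup [] = []
  unique⇒nodup (a ∷ u) = all≢⇒∉ a ∷ unique⇒nodup u
    where
    all≢⇒∉ : ∀ {A : Set} {x : A} {xs} → All (λ y → x ≢ y) xs → x ∉ xs
    all≢⇒∉ (px ∷ _) (here refl) = px refl
    all≢⇒∉ (_ ∷ ps) (there m) = all≢⇒∉ ps m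

  filterB : {A : Set} → (A → Bool) → List A → List A
  filterB P [] = []
  filterB P (x ∷ xs) = if P x then x ∷ filterB P xs else filterB P xs

  countL : {A : Set} → (A → Bool) → List A → ℕ
  countL P xs = length (filterB P xs)

  length-filter : ∀ {A : Set} {ℓ} {P : Pred A ℓ} (P? : Decidable P) xs →
                  length (filter P? xs) ≡ countL (λ x → does (P? x)) xs
  length-filter P? [] = refl
  length-filter P? (x ∷ xs) with does (P? x)
  ... | true = cong suc (length-filter P? xs)
  ... | false = length-filter P? xs

  countL-++ : ∀ {A : Set} (P : A → Bool) xs ys → countL P (xs ++ ys) ≡ countL P xs + countL P ys
  countL-++ P [] ys = refl
  countL-++ P (x ∷ xs) ys with P x
  ... | true = cong suc (countL-++ P xs ys)
  ... | false = countL-++ P xs ys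

  countL-map : ∀ {A B : Set} (P : B → Bool) (f : A → B) xs → countL P (map f xs) ≡ countL (λ x → P (f x)) xs
  countL-map P f [] = refl
  countL-map P f (x ∷ xs) with P (f x)
  ... | true = cong suc (countL-map P f xs)
  ... | false = countL-map P f xs

  module _ {A : Set} where
    ∈-filterB⁻ : ∀ (P : A → Bool) {x} xs → x ∈ filterB P xs → (x ∈ xs) × (P x ≡ true)
    ∈-filterB⁻ P (y ∷ xs) m with P y in eq
    ∈-filterB⁻ P (y ∷ xs) (here refl) | true = here refl , eq
    ∈-filterB⁻ P (y ∷ xs) (there m) | true with ∈-filterB⁻ P xs m
    ... | m' , p = there m' , p
    ∈-filterB⁻ P (y ∷ xs) m | false with ∈-filterB⁻ P xs m
    ... | m' , p = there m' , p

    ∈-filterB⁺ : ∀ (P : A → Bool) {x} xs → x ∈ xs → P x ≡ true → x ∈ filterB P xs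
    ∈-filterB⁺ P (y ∷ xs) (here refl) e rewrite e = here refl
    ∈-filterB⁺ P (y ∷ xs) (there m) e with P y
    ... | true = there (∈-filterB⁺ P xs m e)
    ... | false = ∈-filterB⁺ P xs m e

    nodup-filterB : ∀ (P : A → Bool) {xs} → NoDup xs → NoDup (filterB P xs)
    nodup-filterB P [] = []
    nodup-filterB P {y ∷ xs} (y∉ ∷ nd) with P y
    ... | true = (λ m → y∉ (proj₁ (∈-filterB⁻ P xs m))) ∷ nodup-filterB P nd
    ... | false = nodup-filterB P nd

    nodup-++ : ∀ {as bs : List A} → NoDup as → NoDup bs → (∀ v → v ∈ as → v ∉ bs) → NoDup (as ++ bs)
    nodup-++ [] nb disjoint = nb
    nodup-++ {a ∷ as} {bs} (a∉ ∷ na) nb disjoint = a∉as++bs ∷ nodup-++ na nb (λ v m → disjoint v (there m))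
      where
      a∉as++bs : a ∉ as ++ bs
      a∉as++bs m with ∈-++⁻ as m
      ... | inj₁ p = a∉ p
      ... | inj₂ p = disjoint a (here refl) p

    ∈-remove : ∀ {x y : A} as bs → y ∈ as ++ (x ∷ bs) → y ≢ x → y ∈ as ++ bs
    ∈-remove [] bs (here refl) ne = ⊥-elim (ne refl)
    ∈-remove [] bs (there m) ne = m
    ∈-remove (a ∷ as) bs (here refl) ne = here refl
    ∈-remove (a ∷ as) bs (there m) ne = there (∈-remove as bs m ne)

    nodup-⊆-length : ∀ {zs} ws → NoDup zs → (∀ z → z ∈ zs → z ∈ ws) → length zs ≤ length ws
    nodup-⊆-length ws [] sub = z≤n
    nodup-⊆-length {z ∷ zs} ws (z∉ ∷ nd) sub with ∈-∃++ (sub z (here refl))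
    ... | as , bs , refl = subst (suc (length zs) ≤_) (sym length-ws)
          (s≤s (subst (length zs ≤_) (length-++ as)
                      (nodup-⊆-length (as ++ bs) nd
                        (λ y m → ∈-remove as bs (sub y (there m)) (λ e → z∉ (subst (_∈ zs) e m))))))
      where
      length-ws : length (as ++ (z ∷ bs)) ≡ suc (length as + length bs)
      length-ws = trans (length-++ as) (+-suc (length as) (length bs))

  module _ {A B : Set} where
    nodup-map : ∀ (f : A → B) {xs} → NoDup xs → (∀ x y → x ∈ xs → y ∈ xs → f x ≡ f y → x ≡ y) →
                NoDup (map f xs)
    nodup-map f [] inj = []
    nodup-map f {x ∷ xs} (x∉ ∷ nd) inj = fx∉ ∷ nodup-map f nd (λ a b ma mb → inj a b (there ma) (there mb))
      where
      fx∉ : f x ∉ map f xs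
      fx∉ m with ∈-map⁻ f m
      ... | y , my , e = x∉ (subst (_∈ xs) (sym (inj x y (here refl) (there my) e)) my)

    count-≤-injection : ∀ (xs : List A) (ys : List B) (P : A → Bool) (Q : B → Bool) (f : A → B) → NoDup xs →
      (∀ x → x ∈ xs → P x ≡ true → f x ∈ ys) → (∀ x → x ∈ xs → P x ≡ true → Q (f x) ≡ true) →
      (∀ x y → x ∈ xs → y ∈ xs → P x ≡ true → P y ≡ true → f x ≡ f y → x ≡ y) → countL P xs ≤ countL Q ys
    count-≤-injection xs ys P Q f nd inys Qf inj = subst (_≤ countL Q ys) (length-map f (filterB P xs))
      (nodup-⊆-length (filterB Q ys) (nodup-map f (nodup-filterB P nd) inj-filtered) sub)
      where
      inj-filtered : ∀ x y → x ∈ filterB P xs → y ∈ filterB P xs → f x ≡ f y → x ≡ y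
      inj-filtered x y mx my e with ∈-filterB⁻ P xs mx | ∈-filterB⁻ P xs my
      ... | ax , px | ay , py = inj x y ax ay px py e
      sub : ∀ z → z ∈ map f (filterB P xs) → z ∈ filterB Q ys
      sub z m with ∈-map⁻ f m
      ... | x , mx , refl with ∈-filterB⁻ P xs mx
      ...   | ax , px = ∈-filterB⁺ Q ys (inys x ax px) (Qf x ax px)

    ∈-concatMap⁻ : ∀ (g : A → List B) ys {v} → v ∈ concatMap g ys → Σ A λ y → (y ∈ ys) × (v ∈ g y)
    ∈-concatMap⁻ g (y ∷ ys) m with ∈-++⁻ (g y) m
    ... | inj₁ p = y , here refl , p
    ... | inj₂ p with ∈-concatMap⁻ g ys p
    ...   | y' , y'∈ , v∈ = y' , there y'∈ , v∈

    ∈-concatMap⁺ : ∀ (g : A → List B) ys {y v} → y ∈ ys → v ∈ g y → v ∈ concatMap g ys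
    ∈-concatMap⁺ g (y ∷ ys) (here refl) m = ∈-++⁺ˡ m
    ∈-concatMap⁺ g (y ∷ ys) (there p) m = ∈-++⁺ʳ (g y) (∈-concatMap⁺ g ys p m)

  module _ {A : Set} where
    nodup-prepend : ∀ {m} (L : List (Vec A m)) ys → NoDup ys → NoDup L →
                    NoDup (concatMap (λ y → map (y ∷_) L) ys)
    nodup-prepend L [] _ _ = []
    nodup-prepend {m} L (y ∷ ys) (y∉ ∷ nys) nL =
      nodup-++ (nodup-map (y ∷_) nL (λ a b _ _ e → proj₂ (∷-injective e))) (nodup-prepend L ys nys nL) disjoint
      where
      disjoint : ∀ v → v ∈ map (y ∷_) L → v ∉ concatMap (λ y → map (y ∷_) L) ys
      disjoint v m1 m2 with ∈-map⁻ (y ∷_) m1 | ∈-concatMap⁻ (λ y → map (y ∷_) L) ys m2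
      ... | w , _ , refl | y' , my' , m3 with ∈-map⁻ (y' ∷_) m3
      ...   | w' , _ , e = y∉ (subst (_∈ ys) (sym (proj₁ (∷-injective e))) my')

    nodup-allVecs : ∀ (xs : List A) n → NoDup xs → NoDup (allVecs xs n)
    nodup-allVecs xs zero nd = (λ ()) ∷ []
    nodup-allVecs xs (suc n) nd = nodup-prepend (allVecs xs n) xs nd (nodup-allVecs xs n nd)

    complete-allVecs : ∀ (xs : List A) n (v : Vec A n) → (∀ x → x ∈ xs) → v ∈ allVecs xs n
    complete-allVecs xs zero [] all = here refl
    complete-allVecs xs (suc n) (x ∷ v) all =
      ∈-concatMap⁺ (λ y → map (y ∷_) (allVecs xs n)) xs (all x) (∈-map⁺ (x ∷_) (complete-allVecs xs n v all))

  bools : List Bool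
  bools = true ∷ false ∷ []

  nodup-bools : NoDup bools
  nodup-bools = (λ { (here ()) ; (there ()) }) ∷ ((λ ()) ∷ [])

  all-bools : ∀ x → x ∈ bools
  all-bools true = here refl
  all-bools false = there (here refl)

  countWords≡countL : ∀ n (P : Vec Bool n → Bool) → countWords n P ≡ countL P (allVecs bools n)
  countWords≡countL zero P with P []
  ... | true = refl
  ... | false = refl
  countWords≡countL (suc n) P = sym (begin
      countL P (map (true ∷_) A ++ (map (false ∷_) A ++ []))
    ≡⟨ countL-++ P (map (true ∷_) A) _ ⟩
      countL P (map (true ∷_) A) + countL P (map (false ∷_) A ++ [])
    ≡⟨ cong (countL P (map (true ∷_) A) +_) (trans (countL-++ P (map (false ∷_) A) []) (+-identityʳ _)) ⟩
      countL P (map (true ∷_) A) + countL P (map (false ∷_) A)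
    ≡⟨ cong₂ _+_ (countL-map P (true ∷_) A) (countL-map P (false ∷_) A) ⟩
      countL (λ v → P (true ∷ v)) A + countL (λ v → P (false ∷ v)) A
    ≡⟨ sym (cong₂ _+_ (countWords≡countL n (λ v → P (true ∷ v))) (countWords≡countL n (λ v → P (false ∷ v)))) ⟩
      countWords (suc n) P ∎)
    where
    open ≡-Reasoning
    A = allVecs bools n

-- Defs states the theorem for vectors π : Vec (Fin n) n; the combinatorics
-- above works with functions ℕ → ℕ.
module VectorFunctions where

  open Words
  open BoolReflection
  open Encoding

  entry : ∀ {n m} → Vec (Fin n) m → ℕ → ℕ
  entry [] i = 0
  entry (x ∷ v) zero = toℕ x
  entry (x ∷ v) (suc i) = entry v i

  entry-lookup : ∀ {n m} (π : Vec (Fin n) m) (i : Fin m) → entry π (toℕ i) ≡ toℕ (lookup π i)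
  entry-lookup (x ∷ π) fz = refl
  entry-lookup (x ∷ π) (fs i) = entry-lookup π i

  entry-bound : ∀ {n m} (π : Vec (Fin n) m) i → i < m → entry π i < n
  entry-bound (x ∷ π) zero _ = toℕ<n x
  entry-bound (x ∷ π) (suc i) (s≤s p) = entry-bound π i p

  entry-fromℕ< : ∀ {n m} (π : Vec (Fin n) m) i (p : i < m) →
                 entry π i ≡ toℕ (lookup π (fromℕ< p))
  entry-fromℕ< π i p = trans (cong (entry π) (sym (toℕ-fromℕ< p))) (entry-lookup π (fromℕ< p))

  involution⇒valid : ∀ {n} (π : Vec (Fin n) n) → IsInvolution π → Avoids321 π →
                     Is321Involution n (entry π)
  involution⇒valid {n} π inv av = record { bounded = entry-bound π ; involutive = involutive ; avoids = avoids }
    where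
    involutive : ∀ i → i < n → entry π (entry π i) ≡ i
    involutive i p = begin
        entry π (entry π i)
      ≡⟨ cong (entry π) (entry-fromℕ< π i p) ⟩
        entry π (toℕ (lookup π (fromℕ< p)))
      ≡⟨ entry-lookup π (lookup π (fromℕ< p)) ⟩
        toℕ (lookup π (lookup π (fromℕ< p)))
      ≡⟨ cong toℕ (inv (fromℕ< p)) ⟩
        toℕ (fromℕ< p)
      ≡⟨ toℕ-fromℕ< p ⟩
        i ∎
      where open ≡-Reasoning
    avoids : ∀ i j l → i < j → j < l → l < n → entry π j < entry π i → entry π l < entry π j → ⊥
    avoids i j l i<j j<l l<n a b = av (fi , fj , fl , c1 , c2 , c3 , c4)
      where
      j<n = <-trans j<l l<n
      i<n = <-trans i<j j<n
      fi = fromℕ< i<n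
      fj = fromℕ< j<n
      fl = fromℕ< l<n
      c1 : toℕ fi < toℕ fj
      c1 = subst₂ _<_ (sym (toℕ-fromℕ< i<n)) (sym (toℕ-fromℕ< j<n)) i<j
      c2 : toℕ fj < toℕ fl
      c2 = subst₂ _<_ (sym (toℕ-fromℕ< j<n)) (sym (toℕ-fromℕ< l<n)) j<l
      c3 : toℕ (lookup π fj) < toℕ (lookup π fi)
      c3 = subst₂ _<_ (entry-fromℕ< π j j<n) (entry-fromℕ< π i i<n) a
      c4 : toℕ (lookup π fl) < toℕ (lookup π fj)
      c4 = subst₂ _<_ (entry-fromℕ< π l l<n) (entry-fromℕ< π j j<n) b

  -- x as an element of Fin n, reduced mod n; the Fin n argument witnesses n ≠ 0
  toFin : ∀ {n} → Fin n → ℕ → Fin n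
  toFin {suc n} _ x = x mod suc n

  toFin-ok : ∀ {n} (i : Fin n) x → x < n → toℕ (toFin i x) ≡ x
  toFin-ok {suc n} i x p = trans (toℕ-fromℕ< _) (m<n⇒m%n≡m p)

  tabulateℕ : ∀ n → (ℕ → ℕ) → Vec (Fin n) n
  tabulateℕ n G = tabulate (λ i → toFin i (G (toℕ i)))

  entry-tabulateℕ : ∀ n G → (∀ i → i < n → G i < n) →
                    ∀ i → i < n → entry (tabulateℕ n G) i ≡ G i
  entry-tabulateℕ n G bd i p = begin
      entry (tabulateℕ n G) i
    ≡⟨ entry-fromℕ< (tabulateℕ n G) i p ⟩
      toℕ (lookup (tabulateℕ n G) (fromℕ< p))
    ≡⟨ cong toℕ (lookup∘tabulate _ (fromℕ< p)) ⟩
      toℕ (toFin (fromℕ< p) (G (toℕ (fromℕ< p))))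
    ≡⟨ cong (λ z → toℕ (toFin (fromℕ< p) (G z))) (toℕ-fromℕ< p) ⟩
      toℕ (toFin (fromℕ< p) (G i))
    ≡⟨ toFin-ok (fromℕ< p) (G i) (bd i p) ⟩
      G i ∎
    where open ≡-Reasoning

  tabulateℕ-valid : ∀ n G → Is321Involution n G →
                    IsInvolution (tabulateℕ n G) × Avoids321 (tabulateℕ n G)
  tabulateℕ-valid n G V = inv , av
    where
    open Is321Involution V
    π = tabulateℕ n G
    eqG : ∀ i → i < n → entry π i ≡ G i
    eqG = entry-tabulateℕ n G bounded
    lk : ∀ (x : Fin n) → toℕ (lookup π x) ≡ G (toℕ x)
    lk x = trans (sym (entry-lookup π x)) (eqG (toℕ x) (toℕ<n x))
    inv : IsInvolution π
    inv x = toℕ-injective (begin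
        toℕ (lookup π (lookup π x))
      ≡⟨ lk (lookup π x) ⟩
        G (toℕ (lookup π x))
      ≡⟨ cong G (lk x) ⟩
        G (G (toℕ x))
      ≡⟨ involutive (toℕ x) (toℕ<n x) ⟩
        toℕ x ∎)
      where open ≡-Reasoning
    av : Avoids321 π
    av (x , y , z , c1 , c2 , c3 , c4) = avoids (toℕ x) (toℕ y) (toℕ z) c1 c2 (toℕ<n z)
      (subst₂ _<_ (lk y) (lk x) c3) (subst₂ _<_ (lk z) (lk y) c4)

  entry-ext : ∀ {n m} (π σ : Vec (Fin n) m) → (∀ i → i < m → entry π i ≡ entry σ i) → π ≡ σ
  entry-ext [] [] e = refl
  entry-ext (x ∷ π) (y ∷ σ) e =
    cong₂ _∷_ (toℕ-injective (e 0 (s≤s z≤n))) (entry-ext π σ (λ i p → e (suc i) (s≤s p)))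

  letter-ext : ∀ {m} (v w : Vec Bool m) → (∀ i → i < m → letter v i ≡ letter w i) → v ≡ w
  letter-ext [] [] e = refl
  letter-ext (x ∷ v) (y ∷ w) e =
    cong₂ _∷_ (e 0 (s≤s z≤n)) (letter-ext v w (λ i p → e (suc i) (s≤s p)))

  encodeFrom : ∀ {n m} → ℕ → Vec (Fin n) m → Vec Bool m
  encodeFrom o [] = []
  encodeFrom o (x ∷ v) = (o ≤ᵇ toℕ x) ∷ encodeFrom (suc o) v

  encode : ∀ {n m} → Vec (Fin n) m → Vec Bool m
  encode = encodeFrom 0

  letter-encodeFrom : ∀ {n m} o (v : Vec (Fin n) m) i → i < m →
                      letter (encodeFrom o v) i ≡ ((o + i) ≤ᵇ entry v i)
  letter-encodeFrom o (x ∷ v) zero _ = cong (_≤ᵇ toℕ x) (sym (+-identityʳ o))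
  letter-encodeFrom o (x ∷ v) (suc i) (s≤s p) =
    trans (letter-encodeFrom (suc o) v i p) (cong (_≤ᵇ entry v i) (sym (+-suc o i)))

  letter-encode : ∀ {n m} (v : Vec (Fin n) m) i → i < m →
                  letter (encode v) i ≡ openerWord (entry v) i
  letter-encode v i p = letter-encodeFrom 0 v i p


module DescentStatistics where

  open Words
  open Encoding
  open VectorFunctions

  at : List ℕ → ℕ → ℕ
  at [] _ = 0
  at (x ∷ xs) zero = x
  at (x ∷ xs) (suc i) = at xs i

  -- L has a descent between the 0-based positions i and i+1
  descentAt : List ℕ → ℕ → Bool
  descentAt L i = at L (suc i) <ᵇ at L i

  sumTo-sucL : ∀ f N → sumTo f (suc N) ≡ f 0 + sumTo (λ i → f (suc i)) N
  sumTo-sucL f zero = +-comm 0 (f 0)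
  sumTo-sucL f (suc N) = trans (cong (_+ f (suc N)) (sumTo-sucL f N)) (+-assoc (f 0) _ _)

  descents-length : ∀ p L →
    length (descentPositions p L) ≡ sumTo (λ i → ind (descentAt L i)) (pred (length L))
  descents-length p [] = refl
  descents-length p (x ∷ []) = refl
  descents-length p (x ∷ y ∷ r) =
    trans (first (y <ᵇ x) (descents-length (suc p) (y ∷ r)))
          (sym (sumTo-sucL (λ i → ind (descentAt (x ∷ y ∷ r) i)) (length r)))
    where
    rest = descentPositions (suc p) (y ∷ r)
    first : ∀ c → length rest ≡ sumTo (λ i → ind (descentAt (y ∷ r) i)) (length r) →
            length (if c then p ∷ rest else rest) ≡ ind c + sumTo (λ i → ind (descentAt (y ∷ r) i)) (length r)
    first true ih = cong suc ih
    first false ih = ih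

  descents-sum : ∀ p L →
    sum (descentPositions p L) ≡ sumTo (λ i → if descentAt L i then p + i else 0) (pred (length L))
  descents-sum p [] = refl
  descents-sum p (x ∷ []) = refl
  descents-sum p (x ∷ y ∷ r) =
    trans (first (y <ᵇ x) (trans (descents-sum (suc p) (y ∷ r)) (sumTo-congL (length r) renumber)))
          (sym (sumTo-sucL (λ i → if descentAt (x ∷ y ∷ r) i then p + i else 0) (length r)))
    where
    rest = descentPositions (suc p) (y ∷ r)
    S = sumTo (λ i → if descentAt (y ∷ r) i then p + suc i else 0) (length r)
    renumber : ∀ i → i < length r → (if descentAt (y ∷ r) i then suc p + i else 0)
                                  ≡ (if descentAt (y ∷ r) i then p + suc i else 0)
    renumber i _ = cong (λ z → if descentAt (y ∷ r) i then z else 0) (sym (+-suc p i))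
    first : ∀ c → sum rest ≡ S → sum (if c then p ∷ rest else rest) ≡ (if c then p + 0 else 0) + S
    first true ih = cong₂ _+_ (sym (+-identityʳ p)) ih
    first false ih = ih

  at-toList : ∀ {n m} (π : Vec (Fin n) m) i → at (toList (Vec.map toℕ π)) i ≡ entry π i
  at-toList [] i = refl
  at-toList (x ∷ π) zero = refl
  at-toList (x ∷ π) (suc i) = at-toList π i

  length-toList : ∀ {n m} (π : Vec (Fin n) m) → length (toList (Vec.map toℕ π)) ≡ m
  length-toList [] = refl
  length-toList (x ∷ π) = cong suc (length-toList π)

  <pred⇒suc< : ∀ n i → i < pred n → suc i < n
  <pred⇒suc< (suc n') i p = s≤s p

  descentAt≡peak : ∀ {n} (π : Vec (Fin n) n) → Is321Involution n (entry π) → ∀ i → i < pred n →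
                   descentAt (toList (Vec.map toℕ π)) i ≡ peak (letter (encode π)) i
  descentAt≡peak {n} π V i i<pn = begin
      descentAt (toList (Vec.map toℕ π)) i
    ≡⟨ cong₂ _<ᵇ_ (at-toList π (suc i)) (at-toList π i) ⟩
      entry π (suc i) <ᵇ entry π i
    ≡⟨ OfInvolution.descent≡peak V i si<n ⟩
      peak (openerWord (entry π)) i
    ≡⟨ sym (cong₂ (λ a c → a ∧ not c) (letter-encode π i (<-trans (n<1+n i) si<n)) (letter-encode π (suc i) si<n)) ⟩
      peak (letter (encode π)) i ∎
    where
    open ≡-Reasoning
    si<n = <pred⇒suc< n i i<pn

  des≡peakCount : ∀ {n} (π : Vec (Fin n) n) → Is321Involution n (entry π) →
                  des π ≡ peakCount (letter (encode π)) (pred n)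
  des≡peakCount {n} π V =
    trans (descents-length 1 L)
      (trans (cong (λ z → sumTo (λ i → ind (descentAt L i)) (pred z)) (length-toList π))
             (sumTo-congL (pred n) (λ i i<pn → cong ind (descentAt≡peak π V i i<pn))))
    where L = toList (Vec.map toℕ π)

  maj≡peakSum : ∀ {n} (π : Vec (Fin n) n) → Is321Involution n (entry π) →
                maj π ≡ peakSum (letter (encode π)) (pred n)
  maj≡peakSum {n} π V =
    trans (descents-sum 1 L)
      (trans (cong (λ z → sumTo (λ i → if descentAt L i then 1 + i else 0) (pred z)) (length-toList π))
             (sumTo-congL (pred n) (λ i i<pn → cong (λ c → if c then suc i else 0) (descentAt≡peak π V i i<pn))))
    where L = toList (Vec.map toℕ π)

-- The bijection between the counted involutions and the counted ballot words.
-- π ↦ encode π sends 321-avoiding involutions with des = k and maj = m to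
-- ballot words with k peaks and peak sum m, and is injective on them
-- (EncodingInjective); decoding goes back and is injective because
-- encode ∘ decode is the identity on ballot words.  Injections both ways
-- between the two filtered lists give equal counts.
module Bijection (n k m : ℕ) where

  open Words
  open BoolReflection
  open FiniteCounting
  open Encoding
  open EncodingInjective
  open Decoding
  open VectorFunctions
  open DescentStatistics

  dec-witness : ∀ {P : Set} (d : Dec P) → does d ≡ true → P
  dec-witness (yes p) _ = p
  dec-witness (no _) ()

  isCountedMap : Vec (Fin n) n → Bool
  isCountedMap π = does (isInvolution? π) ∧ (does (avoids321? π) ∧ (does (des π ≟ k) ∧ does (maj π ≟ m)))

  isCountedWord : Vec Bool n → Bool
  isCountedWord v =
    isBallot (letter v) n ∧ ((peakCount (letter v) (pred n) ≡ᵇ k) ∧ (peakSum (letter v) (pred n) ≡ᵇ m))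

  decodeWord : Vec Bool n → Vec (Fin n) n
  decodeWord v = tabulateℕ n (DecodeDefs.decode n (letter v))

  lhsCoeff≡countL : lhsCoeff n k m ≡ countL isCountedMap (allMaps n)
  lhsCoeff≡countL =
    length-filter (λ π → isInvolution? π ×-dec (avoids321? π ×-dec ((des π ≟ k) ×-dec (maj π ≟ m)))) (allMaps n)

  module CountedMap (π : Vec (Fin n) n) (counted : isCountedMap π ≡ true) where
    private
      rest₁ = ∧-true₂ {does (isInvolution? π)} counted
      rest₂ = ∧-true₂ {does (avoids321? π)} rest₁
    involution : IsInvolution π
    involution = dec-witness (isInvolution? π) (∧-true₁ {does (isInvolution? π)} counted)
    avoids : Avoids321 π
    avoids = dec-witness (avoids321? π) (∧-true₁ {does (avoids321? π)} rest₁)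
    des≡k : des π ≡ k
    des≡k = dec-witness (des π ≟ k) (∧-true₁ {does (des π ≟ k)} rest₂)
    maj≡m : maj π ≡ m
    maj≡m = dec-witness (maj π ≟ m) (∧-true₂ {does (des π ≟ k)} rest₂)
    valid : Is321Involution n (entry π)
    valid = involution⇒valid π involution avoids

  encode-counted : ∀ π → isCountedMap π ≡ true → isCountedWord (encode π) ≡ true
  encode-counted π counted = cong₂ _∧_
    (trans (isBallot-cong (letter-encode π) n ≤-refl) (OfInvolution.openerWord-ballot valid))
    (cong₂ _∧_ (eqb-true _ _ (trans (sym (des≡peakCount π valid)) des≡k))
               (eqb-true _ _ (trans (sym (maj≡peakSum π valid)) maj≡m)))
    where open CountedMap π counted

  encode-injective : ∀ π σ → isCountedMap π ≡ true → isCountedMap σ ≡ true → encode π ≡ encode σ → π ≡ σ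
  encode-injective π σ cπ cσ same = entry-ext π σ
    (encoding-injective (CountedMap.valid π cπ) (CountedMap.valid σ cσ) (λ i p →
      trans (sym (letter-encode π i p)) (trans (cong (λ z → letter z i) same) (letter-encode σ i p))))

  module CountedWord (v : Vec Bool n) (counted : isCountedWord v ≡ true) where
    private
      rest = ∧-true₂ {isBallot (letter v) n} counted
      ballot = ∧-true₁ {isBallot (letter v) n} counted
      module D = Decode n (letter v) ballot
      decodedValid = tabulateℕ-valid n D.decode D.decode-valid
    peakCount≡k : peakCount (letter v) (pred n) ≡ k
    peakCount≡k = eqb-sound _ _ (∧-true₁ {peakCount (letter v) (pred n) ≡ᵇ k} rest)
    peakSum≡m : peakSum (letter v) (pred n) ≡ m
    peakSum≡m = eqb-sound _ _ (∧-true₂ {peakCount (letter v) (pred n) ≡ᵇ k} rest)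
    involution : IsInvolution (decodeWord v)
    involution = proj₁ decodedValid
    avoids : Avoids321 (decodeWord v)
    avoids = proj₂ decodedValid
    valid : Is321Involution n (entry (decodeWord v))
    valid = involution⇒valid (decodeWord v) involution avoids
    encode-decode : encode (decodeWord v) ≡ v
    encode-decode = letter-ext (encode (decodeWord v)) v (λ i p →
      trans (letter-encode (decodeWord v) i p)
            (trans (cong (i ≤ᵇ_) (entry-tabulateℕ n D.decode (Is321Involution.bounded D.decode-valid) i p))
                   (D.decode-word i p)))

  decode-counted : ∀ v → isCountedWord v ≡ true → isCountedMap (decodeWord v) ≡ true
  decode-counted v counted = cong₂ _∧_ (dec-true (isInvolution? π) involution)
    (cong₂ _∧_ (dec-true (avoids321? π) avoids)
      (cong₂ _∧_ (dec-true (des π ≟ k) (trans (des≡peakCount π valid)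
                                              (trans (cong (λ z → peakCount (letter z) (pred n)) encode-decode) peakCount≡k)))
                 (dec-true (maj π ≟ m) (trans (maj≡peakSum π valid)
                                              (trans (cong (λ z → peakSum (letter z) (pred n)) encode-decode) peakSum≡m)))))
    where
    open CountedWord v counted
    π = decodeWord v

  decode-injective : ∀ v w → isCountedWord v ≡ true → isCountedWord w ≡ true → decodeWord v ≡ decodeWord w → v ≡ w
  decode-injective v w cv cw same =
    trans (sym (CountedWord.encode-decode v cv)) (trans (cong encode same) (CountedWord.encode-decode w cw))

  counts-agree : countL isCountedMap (allMaps n) ≡ countL isCountedWord (allVecs bools n)
  counts-agree = ≤-antisym
    (count-≤-injection (allMaps n) (allVecs bools n) isCountedMap isCountedWord encode
      (nodup-allVecs (allFin n) n (unique⇒nodup (allFin⁺ n)))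
      (λ π _ _ → complete-allVecs bools n (encode π) all-bools)
      (λ π _ → encode-counted π)
      (λ π σ _ _ → encode-injective π σ))
    (count-≤-injection (allVecs bools n) (allMaps n) isCountedWord isCountedMap decodeWord
      (nodup-allVecs bools n nodup-bools)
      (λ v _ _ → complete-allVecs (allFin n) n (decodeWord v) ∈-allFin)
      (λ v _ → decode-counted v)
      (λ v w _ _ → decode-injective v w))

-- The chain: filter-count of maps = count of ballot words (Bijection)
-- = q^{k²}[⌈n/2⌉,k][⌊n/2⌋,k] (BallotTheorem).
corollary3p6 : ∀ (n k : ℕ) → k < n → ∀ (m : ℕ) →
    lhsCoeff n k m ≡ shift (k * k) (qbinom ⌈ n /2⌉ k ⋆ qbinom ⌊ n /2⌋ k) m
corollary3p6 n k _ m = begin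
    lhsCoeff n k m
  ≡⟨ lhsCoeff≡countL ⟩
    countL isCountedMap (allMaps n)
  ≡⟨ counts-agree ⟩
    countL isCountedWord (allVecs bools n)
  ≡⟨ sym (countWords≡countL n isCountedWord) ⟩
    ballotWordCount n k m
  ≡⟨ ballotWordCount≡gaussProd n k m ⟩
    gaussProd ⌈ n /2⌉ ⌊ n /2⌋ k m ∎
  where
  open ≡-Reasoning
  open Bijection n k m
  open FiniteCounting using (countL; bools; countWords≡countL)
  open BallotTheorem using (ballotWordCount; ballotWordCount≡gaussProd)
  open GaussianProducts using (gaussProd)
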